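{- Let $n\ge 6$ and let $\mathcal F=\{A\subseteq[n]:\ A\neq\emptyset\text{ and for every }i\in A,\ i-1\in A\text{ or }i+1\in A\}$, i.e. the family of all nonempty unions of sets from $\{\{1,2\},\{2,3\},\dots,\{n-1,n\}\}$. Let $k$ be a positive integer with $k\le n-5$, and let $A\subseteq[n]$ with $A\notin\mathcal F$ and $|A|\le n-k-1$. Consider the conditions: (i) $\{1\}\subseteq A\subseteq\{1,3,4,\dots,n\}$; (ii) $\{n\}\subseteq A\subseteq\{1,2,\dots,n-2,n\}$; (iii) $\{1,2\}\subseteq A\subseteq\{1,2,\dots,n-1\}$ and $|A|=n-k-1$; (iv) $\{n-1,n\}\subseteq A\subseteq\{2,3,\dots,n\}$ and $|A|=n-k-1$; (v) $A\subseteq\{2,3,\dots,n-1\}$ and $|A|=n-k-1$; (vi) $\{1,2,n-1,n\}\subseteq A$ and $|A|=n-k-1$; (vii) $A\subseteq\{1,\dots,n-2\}$, $A\cap\{1,2\}\ne\emptyset$, $|A|=n-k-2$ and $A\setminus\{\max A\}\notin\mathcal F$; (viii) $A\subseteq\{3,\dots,n\}$, $A\cap\{n-1,n\}\neq\emptyset$, $|A|=n-k-2$ and $A\setminus\{\min A\}\notin\mathcal F$; (ix) $|A|=n-k-2$, $A\cap\{1,2\}\ne\emptyset$ and $A\cap\{n-1,n\}\ne\emptyset$; (x) $A\subseteq\{1,\dots,n-2\}$, $|A|=n-k-2$ and $A\setminus\{\max A\}\in\mathcal F$; (xi) $A\subseteq\{3,\dots,n\}$, $|A|=n-k-2$ and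 $A\setminus\{\min A\}\in\mathcal F$; (xii) $A\subseteq\{3,\dots,n-2\}$, $|A|=n-k-2$, and there is $j\in A$ with $\min A<j<\max A$ and $j-1,j+1\notin A$; (xiii) $A\subseteq\{3,\dots,n-2\}$, $|A|=n-k-2$, and for every $j\in A$ with $\min A<j<\max A$ we have $j-1\in A$ or $j+1\in A$; (xiv) $|A|\le n-k-3$. If $A$ satisfies any of (i), (ii), (vii), (viii), (ix), (xii), (xiv), then $A\notin\overline{\mathcal F}^{(k)}$. If $A$ satisfies any of (iii), (iv), (v), (vi), (x), (xi), (xiii), then $A\in\overline{\mathcal F}^{(k)}$.
   Context: A family of subsets of $[n]$ is union-closed over $[n]$ if it contains $[n]$ and is closed under pairwise unions. Convention: the empty set is never a member of any family considered; $2^{[n]}$ denotes the family of all nonempty subsets of $[n]$. The closure of a union-closed $\mathcal F$ is $\overline{\mathcal F}=\{A\in 2^{[n]}:\ \mathcal F\cup\{A\}\text{ is union-closed}\}$; iterated closures are $\overline{\mathcal F}^{(0)}=\mathcal F$, $\overline{\mathcal F}^{(i)}=\overline{\overline{\mathcal F}^{(i-1)}}$. $\max A$ and $\min A$ denote the largest and smallest elements of $A$. -}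

module Defs where

open import Data.Nat using (ℕ; zero; suc; _≤_; _<_; _∸_)
open import Data.Fin using (Fin; toℕ)
open import Data.Fin.Subset using (Subset; _∈_; _∉_; _∪_; _-_; ⊤; ∣_∣; Nonempty)
open import Data.Product using (Σ; ∃; _×_)
open import Data.Sum using (_⊎_)
open import Relation.Nullary using (¬_)
open import Relation.Binary.PropositionalEquality using (_≡_; _≢_)

-- A subset of [n] = {1,…,n} is a Subset n; the element x : Fin n stands for
-- the integer  lab x = toℕ x + 1  ∈ [n].
lab : ∀ {n} → Fin n → ℕ
lab x = suc (toℕ x)

_∈ℕ_ : ∀ {n} → ℕ → Subset n → Set
i ∈ℕ A = ∃ λ x → lab x ≡ i × x ∈ A

Family : ℕ → Set₁
Family n = Subset n → Set

UnionClosed : ∀ {n} → Family n → Set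
UnionClosed {n} 𝓕 = 𝓕 ⊤ × (∀ (B C : Subset n) → 𝓕 B → 𝓕 C → 𝓕 (B ∪ C))

insert : ∀ {n} → Subset n → Family n → Family n
insert A 𝓕 X = X ≡ A ⊎ 𝓕 X

closure : ∀ {n} → Family n → Family n
closure 𝓕 A = Nonempty A × UnionClosed (insert A 𝓕)

closureIter : ∀ {n} → ℕ → Family n → Family n
closureIter zero    𝓕 = 𝓕
closureIter (suc i) 𝓕 = closure (closureIter i 𝓕)

PathFam : ∀ n → Family n
PathFam n A = Nonempty A ×
  (∀ (x : Fin n) → x ∈ A → (toℕ x ∈ℕ A) ⊎ (suc (lab x) ∈ℕ A))

IsMax : ∀ {n} → Subset n → Fin n → Set
IsMax A m = m ∈ A × (∀ y → y ∈ A → toℕ y ≤ toℕ m)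

IsMin : ∀ {n} → Subset n → Fin n → Set
IsMin A m = m ∈ A × (∀ y → y ∈ A → toℕ m ≤ toℕ y)

-- A \ {max A} ∈ 𝓕   (max A exists whenever A is nonempty, and is unique)
DelMaxIn : ∀ {n} → Family n → Subset n → Set
DelMaxIn 𝓕 A = ∃ λ m → IsMax A m × 𝓕 (A - m)

DelMaxNotIn : ∀ {n} → Family n → Subset n → Set
DelMaxNotIn 𝓕 A = ∃ λ m → IsMax A m × ¬ 𝓕 (A - m)

DelMinIn : ∀ {n} → Family n → Subset n → Set
DelMinIn 𝓕 A = ∃ λ m → IsMin A m × 𝓕 (A - m)

DelMinNotIn : ∀ {n} → Family n → Subset n → Set
DelMinNotIn 𝓕 A = ∃ λ m → IsMin A m × ¬ 𝓕 (A - m)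

module Conditions (n k : ℕ) (A : Subset n) where
  𝓕 = PathFam n

  Within : ℕ → ℕ → Set
  Within a b = ∀ x → x ∈ A → a ≤ lab x × lab x ≤ b

  c1 c2 c3 c4 c5 c6 c7 c8 c9 c10 c11 c12 c13 c14 : Set
  c1 = (1 ∈ℕ A) × (∀ x → x ∈ A → lab x ≢ 2)
  c2 = (n ∈ℕ A) × (∀ x → x ∈ A → lab x ≢ n ∸ 1)
  c3 = (1 ∈ℕ A) × (2 ∈ℕ A) × Within 1 (n ∸ 1) × ∣ A ∣ ≡ n ∸ k ∸ 1
  c4 = ((n ∸ 1) ∈ℕ A) × (n ∈ℕ A) × Within 2 n × ∣ A ∣ ≡ n ∸ k ∸ 1
  c5 = Within 2 (n ∸ 1) × ∣ A ∣ ≡ n ∸ k ∸ 1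
  c6 = (1 ∈ℕ A) × (2 ∈ℕ A) × ((n ∸ 1) ∈ℕ A) × (n ∈ℕ A) × ∣ A ∣ ≡ n ∸ k ∸ 1
  c7 = Within 1 (n ∸ 2) × ((1 ∈ℕ A) ⊎ (2 ∈ℕ A)) × ∣ A ∣ ≡ n ∸ k ∸ 2
       × DelMaxNotIn 𝓕 A
  c8 = Within 3 n × (((n ∸ 1) ∈ℕ A) ⊎ (n ∈ℕ A)) × ∣ A ∣ ≡ n ∸ k ∸ 2
       × DelMinNotIn 𝓕 A
  c9 = ∣ A ∣ ≡ n ∸ k ∸ 2 × ((1 ∈ℕ A) ⊎ (2 ∈ℕ A)) × (((n ∸ 1) ∈ℕ A) ⊎ (n ∈ℕ A))
  c10 = Within 1 (n ∸ 2) × ∣ A ∣ ≡ n ∸ k ∸ 2 × DelMaxIn 𝓕 A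
  c11 = Within 3 n × ∣ A ∣ ≡ n ∸ k ∸ 2 × DelMinIn 𝓕 A
  c12 = Within 3 (n ∸ 2) × ∣ A ∣ ≡ n ∸ k ∸ 2 ×
        (∃ λ j → j ∈ A × (∃ λ mn → ∃ λ mx → IsMin A mn × IsMax A mx
           × toℕ mn < toℕ j × toℕ j < toℕ mx)
           × ¬ (toℕ j ∈ℕ A) × ¬ (suc (lab j) ∈ℕ A))
  c13 = Within 3 (n ∸ 2) × ∣ A ∣ ≡ n ∸ k ∸ 2 ×
        (∀ j → j ∈ A → ∀ mn mx → IsMin A mn → IsMax A mx
           → toℕ mn < toℕ j → toℕ j < toℕ mx
           → (toℕ j ∈ℕ A) ⊎ (suc (lab j) ∈ℕ A))
  c14 = ∣ A ∣ ≤ n ∸ k ∸ 3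

  NegCond PosCond : Set
  NegCond = c1 ⊎ c2 ⊎ c7 ⊎ c8 ⊎ c9 ⊎ c12 ⊎ c14
  PosCond = c3 ⊎ c4 ⊎ c5 ⊎ c6 ⊎ c10 ⊎ c11 ⊎ c13

module Submission where

-- A point p ∈ A is *isolated* when p-1, p+1 ∉ A, so 𝓕 is the family of nonempty
-- sets without isolated points.  The *weight* of an isolated point p is 1 when A
-- has points on both sides of p, and otherwise  room p = min(2, p-1, n-p),  the
-- space between p and the end of [n] that p faces.
--
-- The heart of the proof is the characterisation (valid for k + 5 ≤ n)
--     A ∈ 𝓕⁽ᵏ⁾  ⇔  A ∈ 𝓕,  or  k ≥ 1, A ≠ ∅ and  n ≤ k + weight A p + |A|
--                    for every isolated point p of A            ("Admissible k A"),
-- proved by induction on k from the description of the closure of a union-closed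
-- family 𝒢:  A ∈ cl 𝒢  ⇔  A ≠ ∅ and every Y ∈ 𝒢 has A ∪ Y = A or A ∪ Y ∈ 𝒢.
--   * admissible-∪ : the union of an admissible set of level k+1 with an admissible
--     set of level k that it does not absorb is admissible of level k;
--   * obstruct     : an isolated point that violates the bound of level k+1 can be
--     kept isolated while adding a single edge {a, a+1} ∈ 𝓕, producing a set that
--     violates the bound of level k.

open import Defs
open import Data.Nat using (ℕ; zero; suc; _+_; _∸_; _≤_; _<_; z≤n; s≤s; _⊓_; _≡ᵇ_; _<ᵇ_)
open import Data.Nat.Properties
open import Data.Bool using (Bool; true; false; _∨_; _∧_; not; if_then_else_; T)
open import Data.Bool.Properties using (∧-identityʳ; ∨-zeroʳ; ∧-zeroʳ)
open import Data.Fin using (Fin; toℕ; fromℕ<) renaming (zero to fzero; suc to fsuc)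
open import Data.Fin.Subset using (Subset; _∈_; _∪_; _-_; ⊤; ∣_∣; Nonempty; ⁅_⁆; _─_)
  renaming (⊥ to ∅)
open import Data.Fin.Properties using (toℕ-fromℕ<)
open import Data.Fin.Subset.Properties using (∪-assoc; ∪-comm; ∪-idem; p⊆p∪q; nonempty?; Empty-unique)
open import Data.Vec using ([]; _∷_; here; there)
open import Data.Product using (Σ; ∃; _×_; _,_; proj₁; proj₂)
open import Data.Sum using (_⊎_; inj₁; inj₂)
open import Data.Empty using (⊥-elim)
open import Data.Unit using (tt)
open import Relation.Nullary using (¬_; yes; no; Dec)
open import Relation.Binary using (tri<; tri≈; tri>)
open import Relation.Binary.PropositionalEquality
open import Data.Nat.Tactic.RingSolver using (solve-∀)

true≢false : true ≢ false
true≢false ()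

toT : ∀ {b} → b ≡ true → T b
toT refl = tt

fromT : ∀ {b} → T b → b ≡ true
fromT {true} _ = refl

bool-cases : ∀ (b : Bool) → (b ≡ true) ⊎ (b ≡ false)
bool-cases true = inj₁ refl
bool-cases false = inj₂ refl

<ᵇ-t : ∀ {i p} → i < p → (i <ᵇ p) ≡ true
<ᵇ-t lt = fromT (<⇒<ᵇ lt)

<ᵇ-< : ∀ {i p} → (i <ᵇ p) ≡ true → i < p
<ᵇ-< {i} {p} e = <ᵇ⇒< i p (toT e)

≡ᵇ-refl : ∀ i → (i ≡ᵇ i) ≡ true
≡ᵇ-refl i = fromT (≡⇒≡ᵇ i i refl)

≡ᵇ-≡ : ∀ {i p} → (i ≡ᵇ p) ≡ true → i ≡ p
≡ᵇ-≡ {i} {p} e = ≡ᵇ⇒≡ i p (toT e)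

≡ᵇ-f : ∀ {i p} → i ≢ p → (i ≡ᵇ p) ≡ false
≡ᵇ-f {i} {p} ne with bool-cases (i ≡ᵇ p)
... | inj₂ f = f
... | inj₁ t = ⊥-elim (ne (≡ᵇ-≡ t))

∨-t : ∀ {a b} → (a ∨ b) ≡ true → a ≡ true ⊎ b ≡ true
∨-t {true} e = inj₁ refl
∨-t {false} e = inj₂ e

∧-f : ∀ {a b} → (a ∧ b) ≡ false → a ≡ false ⊎ b ≡ false
∧-f {false} e = inj₁ refl
∧-f {true} e = inj₂ e

∧-t : ∀ {a b} → (a ∧ b) ≡ true → a ≡ true × b ≡ true
∧-t {true} e = refl , e

t-∨ˡ : ∀ {a} b → a ≡ true → (a ∨ b) ≡ true
t-∨ˡ b refl = refl

t-∨ʳ : ∀ a {b} → b ≡ true → (a ∨ b) ≡ true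
t-∨ʳ a refl = ∨-zeroʳ a

f-∨ : ∀ {a b} → a ≡ false → b ≡ false → (a ∨ b) ≡ false
f-∨ refl refl = refl

boundedSearch : (Q : ℕ → Set) → (∀ x → Q x ⊎ ¬ Q x) → ∀ N → (∃ λ x → Q x) ⊎ (∀ x → x ≤ N → ¬ Q x)
boundedSearch Q d zero with d 0
... | inj₁ q = inj₁ (0 , q)
... | inj₂ nq = inj₂ λ { .0 z≤n → nq }
boundedSearch Q d (suc N) with d (suc N)
... | inj₁ q = inj₁ (suc N , q)
... | inj₂ nq with boundedSearch Q d N
...   | inj₁ e = inj₁ e
...   | inj₂ h = inj₂ λ x le → below (x ≟ suc N) le
  where
  below : ∀ {x} → Dec (x ≡ suc N) → x ≤ suc N → ¬ Q x
  below (yes refl) _ = nq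
  below {x} (no ne) le = h x (≤-pred (≤∧≢⇒< le ne))

largest : ∀ (g : ℕ → Bool) N i → i ≤ N → g i ≡ true → ∃ λ m → g m ≡ true × (∀ j → j ≤ N → g j ≡ true → j ≤ m)
largest g zero i le e rewrite n≤0⇒n≡0 le = 0 , e , λ j jl _ → jl
largest g (suc N) i le e with bool-cases (g (suc N))
... | inj₁ t = suc N , t , λ j jl _ → jl
... | inj₂ f with i ≟ suc N
...   | yes refl = ⊥-elim (true≢false (trans (sym e) f))
...   | no ne with largest g N i (≤-pred (≤∧≢⇒< le ne)) e
...     | m , gm , h = m , gm , λ j jl gj → h j (≤-pred (≤∧≢⇒< jl (λ { refl → true≢false (trans (sym gj) f) }))) gj

smallest : ∀ (g : ℕ → Bool) N i → i ≤ N → g i ≡ true → ∃ λ m → g m ≡ true × (∀ j → g j ≡ true → m ≤ j)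
smallest g zero i le e rewrite n≤0⇒n≡0 le = 0 , e , λ _ _ → z≤n
smallest g (suc N) i le e with boundedSearch (λ j → j ≤ N × g j ≡ true) earlier? N
  where
  earlier? : ∀ j → (j ≤ N × g j ≡ true) ⊎ ¬ (j ≤ N × g j ≡ true)
  earlier? j with j ≤? N | bool-cases (g j)
  ... | yes l | inj₁ gj = inj₁ (l , gj)
  ... | no l | _ = inj₂ (λ x → l (proj₁ x))
  ... | yes l | inj₂ gj = inj₂ (λ x → true≢false (trans (sym (proj₂ x)) gj))
... | inj₁ (j , jN , gj) = smallest g N j jN gj
... | inj₂ none = i , e , λ j gj → ≮⇒≥ (λ j<i → none j (≤-pred (≤-trans j<i le)) (≤-pred (≤-trans j<i le) , gj))

stepwise-constant : (f : ℕ → Bool) → ∀ lo hi → (∀ t → lo ≤ t → suc t ≤ hi → f t ≡ f (suc t)) →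
  ∀ i j → lo ≤ i → i ≤ j → j ≤ hi → f i ≡ f j
stepwise-constant f lo hi h i zero li ij jh rewrite n≤0⇒n≡0 ij = refl
stepwise-constant f lo hi h i (suc j) li ij jh with i ≟ suc j
... | yes refl = refl
... | no ne = trans (stepwise-constant f lo hi h i j li (≤-pred (≤∧≢⇒< ij ne)) (≤-trans (n≤1+n j) jh))
    (h j (≤-trans li (≤-pred (≤∧≢⇒< ij ne))) jh)

-- Integer membership.  mem A i decides whether the integer i ∈ [n] lies in A;
-- it is false outside [n], so arithmetic on labels needs no range side conditions.

mem : ∀ {n} → Subset n → ℕ → Bool
mem [] _ = false
mem (b ∷ A) zero = false
mem (b ∷ A) (suc zero) = b
mem (b ∷ A) (suc (suc i)) = mem A (suc i)

mem-zero : ∀ {n} (A : Subset n) → mem A 0 ≡ false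
mem-zero [] = refl
mem-zero (b ∷ A) = refl

mem-range : ∀ {n} (A : Subset n) i → mem A i ≡ true → 1 ≤ i × i ≤ n
mem-range [] i ()
mem-range (b ∷ A) zero ()
mem-range (b ∷ A) (suc zero) e = s≤s z≤n , s≤s z≤n
mem-range (b ∷ A) (suc (suc i)) e with mem-range A (suc i) e
... | _ , q = s≤s z≤n , s≤s q

mem-beyond : ∀ {n} (A : Subset n) i → n < i → mem A i ≡ false
mem-beyond A i lt with bool-cases (mem A i)
... | inj₂ f = f
... | inj₁ t = ⊥-elim (<⇒≱ lt (proj₂ (mem-range A i t)))

∈⇒mem : ∀ {n} (A : Subset n) (x : Fin n) → x ∈ A → mem A (lab x) ≡ true
∈⇒mem (b ∷ A) fzero here = refl
∈⇒mem (b ∷ A) (fsuc x) (there p) = ∈⇒mem A x p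

mem⇒∈ : ∀ {n} (A : Subset n) (x : Fin n) → mem A (lab x) ≡ true → x ∈ A
mem⇒∈ (true ∷ A) fzero e = here
mem⇒∈ (false ∷ A) fzero ()
mem⇒∈ (b ∷ A) (fsuc x) e = there (mem⇒∈ A x e)

fromLabel : ∀ {n} i → 1 ≤ i → i ≤ n → Σ (Fin n) λ x → lab x ≡ i
fromLabel {suc n} (suc i) (s≤s _) (s≤s q) = fromℕ< (s≤s q) , cong suc (toℕ-fromℕ< (s≤s q))

mem⇒∈ℕ : ∀ {n} (A : Subset n) i → mem A i ≡ true → i ∈ℕ A
mem⇒∈ℕ A i m with fromLabel i (proj₁ (mem-range A i m)) (proj₂ (mem-range A i m))
... | x , e = x , e , mem⇒∈ A x (subst (λ j → mem A j ≡ true) (sym e) m)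

∈ℕ⇒mem : ∀ {n} (A : Subset n) i → i ∈ℕ A → mem A i ≡ true
∈ℕ⇒mem A i (x , refl , xA) = ∈⇒mem A x xA

∉ℕ⇒absent : ∀ {n} (A : Subset n) i → ¬ (i ∈ℕ A) → mem A i ≡ false
∉ℕ⇒absent A i h with bool-cases (mem A i)
... | inj₂ f = f
... | inj₁ t = ⊥-elim (h (mem⇒∈ℕ A i t))

mem-absent : ∀ {n} (A : Subset n) i → (∀ x → x ∈ A → lab x ≢ i) → mem A i ≡ false
mem-absent A i h with bool-cases (mem A i)
... | inj₂ f = f
... | inj₁ t with mem⇒∈ℕ A i t
...   | x , lx , xA = ⊥-elim (h x xA lx)

mem-extensionality : ∀ {n} (A B : Subset n) → (∀ i → mem A i ≡ mem B i) → A ≡ B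
mem-extensionality [] [] h = refl
mem-extensionality (a ∷ A) (b ∷ B) h = cong₂ _∷_ (h 1) (mem-extensionality A B h')
  where
  h' : ∀ i → mem A i ≡ mem B i
  h' zero = trans (mem-zero A) (sym (mem-zero B))
  h' (suc i) = h (suc (suc i))

mem-∪ : ∀ {n} (A B : Subset n) i → mem (A ∪ B) i ≡ (mem A i ∨ mem B i)
mem-∪ [] [] i = refl
mem-∪ (a ∷ A) (b ∷ B) zero = refl
mem-∪ (a ∷ A) (b ∷ B) (suc zero) = refl
mem-∪ (a ∷ A) (b ∷ B) (suc (suc i)) = mem-∪ A B (suc i)

mem-∪-true : ∀ {n} (A B : Subset n) i → mem (A ∪ B) i ≡ true → mem A i ≡ true ⊎ mem B i ≡ true
mem-∪-true A B i e = ∨-t (trans (sym (mem-∪ A B i)) e)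

absorbed-or-new : ∀ {n} (A Y : Subset n) → A ∪ Y ≡ A ⊎ (∃ λ y → mem Y y ≡ true × mem A y ≡ false)
absorbed-or-new {n} A Y with boundedSearch (λ y → mem Y y ≡ true × mem A y ≡ false) new? n
  where
  new? : ∀ y → (mem Y y ≡ true × mem A y ≡ false) ⊎ ¬ (mem Y y ≡ true × mem A y ≡ false)
  new? y with bool-cases (mem Y y) | bool-cases (mem A y)
  ... | inj₁ t | inj₂ f = inj₁ (t , f)
  ... | inj₂ f | _ = inj₂ (λ x → true≢false (trans (sym (proj₁ x)) f))
  ... | inj₁ _ | inj₁ t = inj₂ (λ x → true≢false (trans (sym t) (proj₂ x)))
... | inj₁ found = inj₂ found
... | inj₂ none = inj₁ (mem-extensionality (A ∪ Y) A λ i → trans (mem-∪ A Y i) (absorbed i))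
  where
  absorbed : ∀ i → (mem A i ∨ mem Y i) ≡ mem A i
  absorbed i with bool-cases (mem A i) | bool-cases (mem Y i)
  ... | inj₁ t | _ rewrite t = refl
  ... | inj₂ f | inj₂ g rewrite f | g = refl
  ... | inj₂ f | inj₁ t = ⊥-elim (none i (proj₂ (mem-range Y i t)) (t , f))

mem-⊤ : ∀ {n} i → 1 ≤ i → i ≤ n → mem (⊤ {n}) i ≡ true
mem-⊤ {suc n} (suc zero) _ _ = refl
mem-⊤ {suc n} (suc (suc i)) _ (s≤s q) = mem-⊤ {n} (suc i) (s≤s z≤n) q

mem-∅ : ∀ {n} i → mem (∅ {n}) i ≡ false
mem-∅ {zero} i = refl
mem-∅ {suc n} zero = refl
mem-∅ {suc n} (suc zero) = refl
mem-∅ {suc n} (suc (suc i)) = mem-∅ {n} (suc i)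

mem-⁅⁆ : ∀ {n} (x : Fin n) i → mem ⁅ x ⁆ i ≡ (i ≡ᵇ lab x)
mem-⁅⁆ fzero zero = refl
mem-⁅⁆ fzero (suc zero) = refl
mem-⁅⁆ {suc n} fzero (suc (suc i)) = mem-∅ {n} (suc i)
mem-⁅⁆ (fsuc x) zero = refl
mem-⁅⁆ (fsuc x) (suc zero) = refl
mem-⁅⁆ (fsuc x) (suc (suc i)) = mem-⁅⁆ x (suc i)

mem-─ : ∀ {n} (A B : Subset n) i → mem (A ─ B) i ≡ (mem A i ∧ not (mem B i))
mem-─ [] [] i = refl
mem-─ (a ∷ A) (b ∷ B) zero = refl
mem-─ (a ∷ A) (true ∷ B) (suc zero) = sym (∧-zeroʳ a)
mem-─ (a ∷ A) (false ∷ B) (suc zero) = sym (∧-identityʳ a)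
mem-─ (a ∷ A) (b ∷ B) (suc (suc i)) = mem-─ A B (suc i)

mem-minus : ∀ {n} (A : Subset n) (x : Fin n) i → mem (A - x) i ≡ (mem A i ∧ not (i ≡ᵇ lab x))
mem-minus A x i = trans (mem-─ A ⁅ x ⁆ i) (cong (λ b → mem A i ∧ not b) (mem-⁅⁆ x i))

mem-minus-other : ∀ {n} (A : Subset n) (m : Fin n) i → i ≢ lab m → mem (A - m) i ≡ mem A i
mem-minus-other A m i ne =
  trans (mem-minus A m i) (trans (cong (λ b → mem A i ∧ not b) (≡ᵇ-f ne)) (∧-identityʳ (mem A i)))

mem-minus-self : ∀ {n} (A : Subset n) (m : Fin n) → mem (A - m) (lab m) ≡ false
mem-minus-self A m =
  trans (mem-minus A m (lab m)) (trans (cong (λ b → mem A (lab m) ∧ not b) (≡ᵇ-refl (lab m)))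
    (∧-zeroʳ (mem A (lab m))))

mem-minus-true : ∀ {n} (A : Subset n) (m : Fin n) i → mem (A - m) i ≡ true → mem A i ≡ true × i ≢ lab m
mem-minus-true A m i e with i ≟ lab m
... | yes refl = ⊥-elim (true≢false (trans (sym e) (mem-minus-self A m)))
... | no ne = trans (sym (mem-minus-other A m i ne)) e , ne

tabulateSubset : ∀ n → (ℕ → Bool) → Subset n
tabulateSubset zero g = []
tabulateSubset (suc n) g = g 1 ∷ tabulateSubset n (λ i → g (suc i))

mem-tabulate : ∀ n g i → 1 ≤ i → i ≤ n → mem (tabulateSubset n g) i ≡ g i
mem-tabulate (suc n) g (suc zero) _ _ = refl
mem-tabulate (suc n) g (suc (suc i)) _ (s≤s q) = mem-tabulate n (λ j → g (suc j)) (suc i) (s≤s z≤n) q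

indicator : Bool → ℕ
indicator true = 1
indicator false = 0

indicator≤1 : ∀ b → indicator b ≤ 1
indicator≤1 true = s≤s z≤n
indicator≤1 false = z≤n

indicator-mono : ∀ a b → (a ≡ true → b ≡ true) → indicator a ≤ indicator b
indicator-mono true b f rewrite f refl = ≤-refl
indicator-mono false b f = z≤n

indicator-∨ : ∀ a b → indicator (a ∨ b) ≤ indicator a + indicator b
indicator-∨ true b = s≤s z≤n
indicator-∨ false b = ≤-refl

count : (ℕ → Bool) → ℕ → ℕ
count g zero = 0
count g (suc N) = count g N + indicator (g (suc N))

count-shift : ∀ g N → count g (suc N) ≡ indicator (g 1) + count (λ i → g (suc i)) N
count-shift g zero = +-comm 0 (indicator (g 1))
count-shift g (suc N) = trans (cong (_+ indicator (g (suc (suc N)))) (count-shift g N))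
  (+-assoc (indicator (g 1)) (count (λ i → g (suc i)) N) _)

count-cong : ∀ g h N → (∀ i → 1 ≤ i → i ≤ N → g i ≡ h i) → count g N ≡ count h N
count-cong g h zero e = refl
count-cong g h (suc N) e = cong₂ _+_ (count-cong g h N (λ i p q → e i p (m≤n⇒m≤1+n q)))
  (cong indicator (e (suc N) (s≤s z≤n) ≤-refl))

card≡count : ∀ {n} (A : Subset n) → ∣ A ∣ ≡ count (mem A) n
card≡count [] = refl
card≡count {suc n} (b ∷ A) = trans (head b) (sym (trans (count-shift (mem (b ∷ A)) n)
   (cong (indicator b +_) (count-cong _ (mem A) n λ { (suc i) _ _ → refl }))))
  where
  head : ∀ b → ∣ b ∷ A ∣ ≡ indicator b + count (mem A) n
  head true = cong suc (card≡count A)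
  head false = card≡count A

count≤ : ∀ g N → count g N ≤ N
count≤ g zero = z≤n
count≤ g (suc N) = ≤-trans (+-mono-≤ (count≤ g N) (indicator≤1 (g (suc N)))) (≤-reflexive (+-comm N 1))

count-all : ∀ g N → (∀ i → 1 ≤ i → i ≤ N → g i ≡ true) → count g N ≡ N
count-all g zero f = refl
count-all g (suc N) f rewrite f (suc N) (s≤s z≤n) ≤-refl
  = trans (cong (_+ 1) (count-all g N (λ i p q → f i p (m≤n⇒m≤1+n q)))) (+-comm N 1)

count-none : ∀ g N → (∀ i → 1 ≤ i → i ≤ N → g i ≡ false) → count g N ≡ 0
count-none g zero f = refl
count-none g (suc N) f rewrite f (suc N) (s≤s z≤n) ≤-refl
  = trans (+-identityʳ _) (count-none g N (λ i p q → f i p (m≤n⇒m≤1+n q)))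

count-mono : ∀ g h N → (∀ i → 1 ≤ i → i ≤ N → g i ≡ true → h i ≡ true) → count g N ≤ count h N
count-mono g h zero f = z≤n
count-mono g h (suc N) f = +-mono-≤ (count-mono g h N (λ i p q → f i p (m≤n⇒m≤1+n q)))
  (indicator-mono (g (suc N)) (h (suc N)) (f (suc N) (s≤s z≤n) ≤-refl))

count-strict : ∀ g h N x → (∀ i → 1 ≤ i → i ≤ N → g i ≡ true → h i ≡ true) →
  1 ≤ x → x ≤ N → g x ≡ false → h x ≡ true → suc (count g N) ≤ count h N
count-strict g h zero .zero f () z≤n gx hx
count-strict g h (suc N) x f p q gx hx with x ≟ suc N
... | yes refl rewrite gx | hx =
  ≤-trans (≤-reflexive (trans (cong suc (+-identityʳ (count g N))) (+-comm 1 (count g N))))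
    (+-monoˡ-≤ 1 (count-mono g h N (λ i p q → f i p (m≤n⇒m≤1+n q))))
... | no ne = +-mono-≤ (count-strict g h N x (λ i p q → f i p (m≤n⇒m≤1+n q)) p
      (≤-pred (≤∧≢⇒< q ne)) gx hx)
  (indicator-mono (g (suc N)) (h (suc N)) (f (suc N) (s≤s z≤n) ≤-refl))

count-∨ : ∀ g h N → count (λ i → g i ∨ h i) N ≤ count g N + count h N
count-∨ g h zero = z≤n
count-∨ g h (suc N) = ≤-trans (+-mono-≤ (count-∨ g h N) (indicator-∨ (g (suc N)) (h (suc N))))
  (≤-reflexive (interchange (count g N) (count h N) (indicator (g (suc N))) (indicator (h (suc N)))))
  where
  interchange : ∀ a b c d → (a + b) + (c + d) ≡ (a + c) + (b + d)
  interchange = solve-∀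

count-single : ∀ g N x → (∀ i → 1 ≤ i → i ≤ N → g i ≡ true → i ≡ x) → count g N ≤ 1
count-single g zero x f = z≤n
count-single g (suc N) x f with bool-cases (g (suc N))
... | inj₂ gN rewrite gN =
  ≤-trans (≤-reflexive (+-identityʳ _)) (count-single g N x (λ i p q → f i p (m≤n⇒m≤1+n q)))
... | inj₁ gN rewrite gN = ≤-reflexive (cong (_+ 1) (count-none g N others))
  where
  others : ∀ i → 1 ≤ i → i ≤ N → g i ≡ false
  others i p q with bool-cases (g i)
  ... | inj₂ gi = gi
  ... | inj₁ gi = ⊥-elim (<-irrefl (trans (f i p (m≤n⇒m≤1+n q) gi) (sym (f (suc N) (s≤s z≤n) ≤-refl gN))) (s≤s q))

count-point : ∀ u N → count (λ i → i ≡ᵇ u) N ≤ 1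
count-point u N = count-single _ N u (λ i _ _ e → ≡ᵇ-≡ e)

count-below : ∀ p N → count (λ i → i <ᵇ p) N ≤ p ∸ 1
count-below p zero = z≤n
count-below p (suc N) with bool-cases (suc N <ᵇ p)
... | inj₂ f rewrite f = ≤-trans (≤-reflexive (+-identityʳ _)) (count-below p N)
... | inj₁ t rewrite t = ≤-trans (+-monoˡ-≤ 1 (count≤ _ N)) (≤-trans (≤-reflexive (+-comm N 1))
     (∸-monoˡ-≤ 1 (<ᵇ-< {suc N} {p} t)))

count-above : ∀ p N → count (λ i → p <ᵇ i) N ≤ N ∸ p
count-above p zero = z≤n
count-above p (suc N) with bool-cases (p <ᵇ suc N)
... | inj₂ f rewrite f = ≤-trans (≤-reflexive (+-identityʳ _)) (≤-trans (count-above p N) (∸-monoˡ-≤ p (n≤1+n N)))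
... | inj₁ t rewrite t = ≤-trans (+-monoˡ-≤ 1 (count-above p N)) (≤-reflexive (trans (+-comm (N ∸ p) 1)
     (sym (+-∸-assoc 1 (≤-pred (<ᵇ-< {p} {suc N} t))))))

count-add-one : ∀ g h N x → (∀ i → 1 ≤ i → i ≤ N → g i ≡ true → h i ≡ true ⊎ i ≡ x) →
  count g N ≤ suc (count h N)
count-add-one g h N x f = ≤-trans (count-mono g (λ i → h i ∨ (i ≡ᵇ x)) N f')
  (≤-trans (count-∨ h (λ i → i ≡ᵇ x) N) (≤-trans (+-monoʳ-≤ (count h N) (count-point x N))
    (≤-reflexive (+-comm (count h N) 1))))
  where
  f' : ∀ i → 1 ≤ i → i ≤ N → g i ≡ true → (h i ∨ (i ≡ᵇ x)) ≡ true
  f' i p q e with f i p q e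
  ... | inj₁ hi = t-∨ˡ (i ≡ᵇ x) hi
  ... | inj₂ refl = t-∨ʳ (h i) (≡ᵇ-refl i)

count-cover : ∀ (g s : ℕ → Bool) N → (∀ i → 1 ≤ i → i ≤ N → g i ≡ true ⊎ s i ≡ true) → N ≤ count g N + count s N
count-cover g s N h = ≤-trans (≤-reflexive (sym (count-all (λ _ → true) N (λ _ _ _ → refl))))
  (≤-trans (count-mono (λ _ → true) (λ i → g i ∨ s i) N covered) (count-∨ g s N))
  where
  covered : ∀ i → 1 ≤ i → i ≤ N → true ≡ true → (g i ∨ s i) ≡ true
  covered i a b _ with h i a b
  ... | inj₁ x = t-∨ˡ (s i) x
  ... | inj₂ x = t-∨ʳ (g i) x

count-add-new : ∀ (g : ℕ → Bool) N x → 1 ≤ x → x ≤ N → g x ≡ false →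
  suc (count g N) ≤ count (λ i → g i ∨ (i ≡ᵇ x)) N
count-add-new g N x a b gx = count-strict g (λ i → g i ∨ (i ≡ᵇ x)) N x (λ i _ _ e → t-∨ˡ (i ≡ᵇ x) e) a b gx
  (t-∨ʳ (g x) (≡ᵇ-refl x))

add-absent : ∀ (g : ℕ → Bool) x y → g y ≡ false → y ≢ x → (g y ∨ (y ≡ᵇ x)) ≡ false
add-absent g x y gy ne = f-∨ gy (≡ᵇ-f ne)

missing₁ : ∀ (g : ℕ → Bool) N x → 1 ≤ x → x ≤ N → g x ≡ false → suc (count g N) ≤ N
missing₁ g N x a b gx = ≤-trans (count-strict g (λ _ → true) N x (λ _ _ _ _ → refl) a b gx refl)
  (≤-reflexive (count-all (λ _ → true) N (λ _ _ _ → refl)))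

missing₂ : ∀ (g : ℕ → Bool) N x y → 1 ≤ x → x < y → y ≤ N → g x ≡ false → g y ≡ false →
  2 + count g N ≤ N
missing₂ g N x y a xy b gx gy = ≤-trans (s≤s (count-add-new g N x a (≤-trans (<⇒≤ xy) b) gx))
  (missing₁ (λ i → g i ∨ (i ≡ᵇ x)) N y (≤-trans a (<⇒≤ xy)) b (add-absent g x y gy (λ e → <-irrefl (sym e) xy)))

missing₃ : ∀ (g : ℕ → Bool) N x y z → 1 ≤ x → x < y → y < z → z ≤ N →
  g x ≡ false → g y ≡ false → g z ≡ false → 3 + count g N ≤ N
missing₃ g N x y z a xy yz b gx gy gz = ≤-trans (s≤s (s≤s (count-add-new g N x a xb gx)))
  (missing₂ (λ i → g i ∨ (i ≡ᵇ x)) N y z (≤-trans a (<⇒≤ xy)) yz b (add-absent g x y gy (λ e → <-irrefl (sym e) xy))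
    (add-absent g x z gz (λ e → <-irrefl (sym e) (<-trans xy yz))))
  where
  xb : x ≤ N
  xb = ≤-trans (<⇒≤ xy) (≤-trans (<⇒≤ yz) b)

AllNonempty : ∀ {n} → Family n → Set
AllNonempty {n} G = ∀ (X : Subset n) → G X → Nonempty X

∪-absorb : ∀ {n} (A₁ A₂ Y : Subset n) → A₁ ∪ (A₂ ∪ Y) ≡ A₁ → (A₁ ∪ A₂) ∪ Y ≡ A₁ ∪ A₂
∪-absorb A₁ A₂ Y e = begin
  (A₁ ∪ A₂) ∪ Y  ≡⟨ ∪-assoc A₁ A₂ Y ⟩
  A₁ ∪ (A₂ ∪ Y)  ≡⟨ e ⟩
  A₁             ≡⟨ sym A₁-absorbs-A₂ ⟩
  A₁ ∪ A₂        ∎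
  where
  open ≡-Reasoning
  A₁-absorbs-A₂ : A₁ ∪ A₂ ≡ A₁
  A₁-absorbs-A₂ = begin
    A₁ ∪ A₂               ≡⟨ cong (_∪ A₂) (sym e) ⟩
    (A₁ ∪ (A₂ ∪ Y)) ∪ A₂  ≡⟨ ∪-assoc A₁ (A₂ ∪ Y) A₂ ⟩
    A₁ ∪ ((A₂ ∪ Y) ∪ A₂)  ≡⟨ cong (A₁ ∪_) (∪-comm (A₂ ∪ Y) A₂) ⟩
    A₁ ∪ (A₂ ∪ (A₂ ∪ Y))  ≡⟨ cong (A₁ ∪_) (sym (∪-assoc A₂ A₂ Y)) ⟩
    A₁ ∪ ((A₂ ∪ A₂) ∪ Y)  ≡⟨ cong (λ Z → A₁ ∪ (Z ∪ Y)) (∪-idem A₂) ⟩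
    A₁ ∪ (A₂ ∪ Y)         ≡⟨ e ⟩
    A₁                    ∎

closure-intro : ∀ {n} (G : Family n) → UnionClosed G → (X : Subset n) → Nonempty X →
  (∀ Y → G Y → X ∪ Y ≡ X ⊎ G (X ∪ Y)) → closure G X
closure-intro G (G⊤ , Gc) X ne h = ne , inj₂ G⊤ , uc
  where
  uc : ∀ B C → insert X G B → insert X G C → insert X G (B ∪ C)
  uc B C (inj₁ refl) (inj₁ refl) = inj₁ (∪-idem X)
  uc B C (inj₁ refl) (inj₂ gC) = h C gC
  uc B C (inj₂ gB) (inj₁ refl) rewrite ∪-comm B X = h B gB
  uc B C (inj₂ gB) (inj₂ gC) = inj₂ (Gc B C gB gC)

closure-elim : ∀ {n} (G : Family n) → (X : Subset n) → closure G X →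
  ∀ Y → G Y → X ∪ Y ≡ X ⊎ G (X ∪ Y)
closure-elim G X (ne , _ , uc) Y gY = uc X Y (inj₁ refl) (inj₂ gY)

⊆closure : ∀ {n} (G : Family n) → UnionClosed G → AllNonempty G → ∀ X → G X → closure G X
⊆closure G (G⊤ , Gc) ne X gX = closure-intro G (G⊤ , Gc) X (ne X gX) (λ Y gY → inj₂ (Gc X Y gX gY))

closure-unionClosed : ∀ {n} (G : Family n) → UnionClosed G → AllNonempty G → UnionClosed (closure G)
closure-unionClosed G (G⊤ , Gc) ne = ⊆closure G (G⊤ , Gc) ne ⊤ G⊤ , uc
  where
  uc : ∀ A₁ A₂ → closure G A₁ → closure G A₂ → closure G (A₁ ∪ A₂)
  uc A₁ A₂ c₁ c₂ = closure-intro G (G⊤ , Gc) (A₁ ∪ A₂) ne₁₂ h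
    where
    ne₁₂ : Nonempty (A₁ ∪ A₂)
    ne₁₂ = proj₁ (proj₁ c₁) , p⊆p∪q A₂ (proj₂ (proj₁ c₁))
    h : ∀ Y → G Y → (A₁ ∪ A₂) ∪ Y ≡ A₁ ∪ A₂ ⊎ G ((A₁ ∪ A₂) ∪ Y)
    h Y gY with closure-elim G A₂ c₂ Y gY
    ... | inj₁ e = inj₁ (trans (∪-assoc A₁ A₂ Y) (cong (A₁ ∪_) e))
    ... | inj₂ gZ with closure-elim G A₁ c₁ (A₂ ∪ Y) gZ
    ...   | inj₁ e = inj₁ (∪-absorb A₁ A₂ Y e)
    ...   | inj₂ g = inj₂ (subst G (sym (∪-assoc A₁ A₂ Y)) g)

closureIter-unionClosed : ∀ {n} (G : Family n) → UnionClosed G → AllNonempty G → ∀ k →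
  UnionClosed (closureIter k G) × AllNonempty (closureIter k G)
closureIter-unionClosed G uc ne zero = uc , ne
closureIter-unionClosed G uc ne (suc k) with closureIter-unionClosed G uc ne k
... | uck , nek = closure-unionClosed (closureIter k G) uck nek , (λ X c → proj₁ c)

⊆closureIter : ∀ {n} (G : Family n) → UnionClosed G → AllNonempty G → ∀ k X → G X → closureIter k G X
⊆closureIter G uc ne zero X g = g
⊆closureIter G uc ne (suc k) X g with closureIter-unionClosed G uc ne k
... | uck , nek = ⊆closure (closureIter k G) uck nek X (⊆closureIter G uc ne k X g)

module Weight (n : ℕ) where

  Isolated : Subset n → ℕ → Set
  Isolated A p = mem A p ≡ true × mem A (p ∸ 1) ≡ false × mem A (suc p) ≡ false

  Inhabited : Subset n → Set
  Inhabited A = ∃ λ i → mem A i ≡ true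

  NoIsolated : Subset n → Set
  NoIsolated A = Inhabited A × (∀ p → ¬ Isolated A p)

  Included : Subset n → Subset n → Set
  Included X C = ∀ i → mem X i ≡ true → mem C i ≡ true

  anyBelow : Subset n → ℕ → ℕ → Bool
  anyBelow A p zero = false
  anyBelow A p (suc N) = ((suc N <ᵇ p) ∧ mem A (suc N)) ∨ anyBelow A p N

  anyAbove : Subset n → ℕ → ℕ → Bool
  anyAbove A p zero = false
  anyAbove A p (suc N) = ((p <ᵇ suc N) ∧ mem A (suc N)) ∨ anyAbove A p N

  hasLeft hasRight flanked : Subset n → ℕ → Bool
  hasLeft A p = anyBelow A p n
  hasRight A p = anyAbove A p n
  flanked A p = hasLeft A p ∧ hasRight A p

  room : ℕ → ℕ
  room p = 2 ⊓ ((p ∸ 1) ⊓ (n ∸ p))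

  weight : Subset n → ℕ → ℕ
  weight A p = if flanked A p then 1 else room p

  BoundAt : ℕ → Subset n → ℕ → Set
  BoundAt k A p = n ≤ k + weight A p + ∣ A ∣

  Bounded : ℕ → Subset n → Set
  Bounded k A = ∀ p → Isolated A p → BoundAt k A p

  Violates : ℕ → Subset n → ℕ → Set
  Violates k A p = k + weight A p + ∣ A ∣ < n

  Admissible : ℕ → Subset n → Set
  Admissible k A = NoIsolated A ⊎ (1 ≤ k × Inhabited A × Bounded k A)

  admissible-bounded : ∀ k A p → Admissible k A → Isolated A p → BoundAt k A p
  admissible-bounded k A p (inj₁ (_ , noiso)) ip = ⊥-elim (noiso p ip)
  admissible-bounded k A p (inj₂ (_ , _ , h)) ip = h p ip

  not-admissible : ∀ k A p → Isolated A p → Violates k A p → ¬ Admissible k A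
  not-admissible k A p ip lt adm = <-irrefl refl (<-≤-trans lt (admissible-bounded k A p adm ip))

  anyBelow-witness : ∀ A p N → anyBelow A p N ≡ true → ∃ λ i → i < p × mem A i ≡ true
  anyBelow-witness A p (suc N) e with ∨-t {(suc N <ᵇ p) ∧ mem A (suc N)} e
  ... | inj₁ e₁ = suc N , <ᵇ-< (proj₁ (∧-t e₁)) , proj₂ (∧-t e₁)
  ... | inj₂ e₂ = anyBelow-witness A p N e₂

  anyBelow-intro : ∀ A p N i → i < p → i ≤ N → mem A i ≡ true → anyBelow A p N ≡ true
  anyBelow-intro A p zero i lt le e rewrite n≤0⇒n≡0 le = ⊥-elim (true≢false (trans (sym e) (mem-zero A)))
  anyBelow-intro A p (suc N) i lt le e with i ≟ suc N
  ... | yes refl rewrite <ᵇ-t lt | e = refl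
  ... | no ne = t-∨ʳ ((suc N <ᵇ p) ∧ mem A (suc N)) (anyBelow-intro A p N i lt (≤-pred (≤∧≢⇒< le ne)) e)

  anyAbove-witness : ∀ A p N → anyAbove A p N ≡ true → ∃ λ i → p < i × mem A i ≡ true
  anyAbove-witness A p (suc N) e with ∨-t {(p <ᵇ suc N) ∧ mem A (suc N)} e
  ... | inj₁ e₁ = suc N , <ᵇ-< (proj₁ (∧-t e₁)) , proj₂ (∧-t e₁)
  ... | inj₂ e₂ = anyAbove-witness A p N e₂

  anyAbove-intro : ∀ A p N i → p < i → i ≤ N → mem A i ≡ true → anyAbove A p N ≡ true
  anyAbove-intro A p zero i lt le e rewrite n≤0⇒n≡0 le = ⊥-elim (true≢false (trans (sym e) (mem-zero A)))
  anyAbove-intro A p (suc N) i lt le e with i ≟ suc N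
  ... | yes refl rewrite <ᵇ-t lt | e = refl
  ... | no ne = t-∨ʳ ((p <ᵇ suc N) ∧ mem A (suc N)) (anyAbove-intro A p N i lt (≤-pred (≤∧≢⇒< le ne)) e)

  hasLeft-intro : ∀ A p i → i < p → mem A i ≡ true → hasLeft A p ≡ true
  hasLeft-intro A p i lt e = anyBelow-intro A p n i lt (proj₂ (mem-range A i e)) e

  hasRight-intro : ∀ A p i → p < i → mem A i ≡ true → hasRight A p ≡ true
  hasRight-intro A p i lt e = anyAbove-intro A p n i lt (proj₂ (mem-range A i e)) e

  noneLeft : ∀ X p c → hasLeft X p ≡ false → c < p → mem X c ≡ false
  noneLeft X p c e lt with bool-cases (mem X c)
  ... | inj₂ f = f
  ... | inj₁ t = ⊥-elim (true≢false (trans (sym (hasLeft-intro X p c lt t)) e))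

  noneRight : ∀ X p c → hasRight X p ≡ false → p < c → mem X c ≡ false
  noneRight X p c e lt with bool-cases (mem X c)
  ... | inj₂ f = f
  ... | inj₁ t = ⊥-elim (true≢false (trans (sym (hasRight-intro X p c lt t)) e))

  hasLeft-mono : ∀ X C p → Included X C → hasLeft X p ≡ true → hasLeft C p ≡ true
  hasLeft-mono X C p s e with anyBelow-witness X p n e
  ... | i , lt , m = hasLeft-intro C p i lt (s i m)

  hasRight-mono : ∀ X C p → Included X C → hasRight X p ≡ true → hasRight C p ≡ true
  hasRight-mono X C p s e with anyAbove-witness X p n e
  ... | i , lt , m = hasRight-intro C p i lt (s i m)

  flanked-mono : ∀ X C p → Included X C → flanked X p ≡ true → flanked C p ≡ true
  flanked-mono X C p s e rewrite hasLeft-mono X C p s (proj₁ (∧-t e)) | hasRight-mono X C p s (proj₂ (∧-t e)) = refl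

  flanked-bounds : ∀ A p → flanked A p ≡ true → 2 ≤ p × p < n
  flanked-bounds A p e with anyBelow-witness A p n (proj₁ (∧-t e)) | anyAbove-witness A p n (proj₂ (∧-t e))
  ... | i , i<p , mi | j , p<j , mj = ≤-trans (s≤s (proj₁ (mem-range A i mi))) i<p ,
        <-≤-trans p<j (proj₂ (mem-range A j mj))

  unflanked-1 : ∀ C → flanked C 1 ≡ false
  unflanked-1 C with bool-cases (flanked C 1)
  ... | inj₂ f = f
  ... | inj₁ t with flanked-bounds C 1 t
  ...   | (s≤s () , _)

  unflanked-n : ∀ C → flanked C n ≡ false
  unflanked-n C with bool-cases (flanked C n)
  ... | inj₂ f = f
  ... | inj₁ t = ⊥-elim (<-irrefl refl (proj₂ (flanked-bounds C n t)))

  flanking-witness : ∀ X C p → flanked X p ≡ false → flanked C p ≡ true →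
    ∃ λ c → mem C c ≡ true × mem X c ≡ false ×
      ((c < p × hasLeft X p ≡ false) ⊎ (p < c × hasRight X p ≡ false))
  flanking-witness X C p ex ec with bool-cases (hasLeft X p)
  ... | inj₂ hl with anyBelow-witness C p n (proj₁ (∧-t ec))
  ...   | c , lt , m = c , m , noneLeft X p c hl lt , inj₁ (lt , hl)
  flanking-witness X C p ex ec | inj₁ hl rewrite hl with anyAbove-witness C p n (proj₂ (∧-t ec))
  ...   | c , lt , m = c , m , noneRight X p c ex lt , inj₂ (lt , ex)

  room≤2 : ∀ p → room p ≤ 2
  room≤2 p = m⊓n≤m 2 _

  room≤left : ∀ p → room p ≤ p ∸ 1
  room≤left p = ≤-trans (m⊓n≤n 2 _) (m⊓n≤m _ _)

  room≤right : ∀ p → room p ≤ n ∸ p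
  room≤right p = ≤-trans (m⊓n≤n 2 _) (m⊓n≤n _ _)

  room-pos : ∀ p → 2 ≤ p → p < n → 1 ≤ room p
  room-pos p a b = ⊓-glb (s≤s z≤n) (⊓-glb (∸-monoˡ-≤ 1 a) (m<n⇒0<n∸m b))

  room≡2 : ∀ p → 3 ≤ p → 2 + p ≤ n → room p ≡ 2
  room≡2 p a b = m≤n⇒m⊓n≡m (⊓-glb (∸-monoˡ-≤ 1 a)
    (≤-trans (≤-reflexive (sym (m+n∸n≡m 2 p))) (∸-monoˡ-≤ p b)))

  room-left : ∀ p → 2 ≤ n ∸ p → p ∸ 1 ≤ 2 → room p ≡ p ∸ 1
  room-left p d2 l2 = trans (cong (2 ⊓_) (m≤n⇒m⊓n≡m (≤-trans l2 d2))) (m≥n⇒m⊓n≡n l2)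

  room-right : ∀ p → 3 ≤ p → n ∸ p ≤ 2 → room p ≡ n ∸ p
  room-right p p3 d2 = trans (cong (2 ⊓_) (m≥n⇒m⊓n≡n (≤-trans d2 (∸-monoˡ-≤ 1 p3)))) (m≥n⇒m⊓n≡n d2)

  weight-flanked : ∀ A p → flanked A p ≡ true → weight A p ≡ 1
  weight-flanked A p e rewrite e = refl

  weight-unflanked : ∀ A p → flanked A p ≡ false → weight A p ≡ room p
  weight-unflanked A p e rewrite e = refl

  weight≤2 : ∀ A p → weight A p ≤ 2
  weight≤2 A p with flanked A p
  ... | true = s≤s z≤n
  ... | false = room≤2 p

  weight≥1 : ∀ A p → 2 ≤ p → p < n → 1 ≤ weight A p
  weight≥1 A p a b with flanked A p
  ... | true = ≤-refl
  ... | false = room-pos p a b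

  -- enlarging a set can only lower weights (an interior point gets weight 1 ≤ room) …
  weight-antitone : ∀ X C p → Included X C → weight C p ≤ weight X p
  weight-antitone X C p s with bool-cases (flanked X p) | bool-cases (flanked C p)
  ... | inj₁ ex | inj₁ ec rewrite ex | ec = ≤-refl
  ... | inj₁ ex | inj₂ ec = ⊥-elim (true≢false (trans (sym (flanked-mono X C p s ex)) ec))
  ... | inj₂ ex | inj₁ ec rewrite ex | ec = room-pos p (proj₁ (flanked-bounds C p ec)) (proj₂ (flanked-bounds C p ec))
  ... | inj₂ ex | inj₂ ec rewrite ex | ec = ≤-refl

  weight-drop : ∀ X C p → Included X C → weight C p < weight X p → flanked C p ≡ true × flanked X p ≡ false
  weight-drop X C p s lt with bool-cases (flanked X p) | bool-cases (flanked C p)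
  ... | inj₁ ex | inj₁ ec rewrite ex | ec = ⊥-elim (<-irrefl refl lt)
  ... | inj₁ ex | inj₂ ec = ⊥-elim (true≢false (trans (sym (flanked-mono X C p s ex)) ec))
  ... | inj₂ ex | inj₁ ec = ec , ex
  ... | inj₂ ex | inj₂ ec rewrite ex | ec = ⊥-elim (<-irrefl refl lt)

  -- An interior isolated point q = r + 2 < n: both neighbours lie outside C, and when q is
  -- unflanked with room 2, so does the point two steps away on the side where C is empty.
  interior-deficit : ∀ C r → suc (suc r) < n → mem C (suc r) ≡ false → mem C (suc (suc (suc r))) ≡ false →
    suc (weight C (suc (suc r)) + count (mem C) n) ≤ n
  interior-deficit C r q<n ml mr = by-cases (bool-cases (flanked C q)) (room q ≤? 1)
    where
    q : ℕ
    q = suc (suc r)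
    cnt : ℕ
    cnt = count (mem C) n
    both-neighbours : 2 + cnt ≤ n
    both-neighbours = missing₂ (mem C) n (suc r) (suc q) (s≤s z≤n) (s≤s (s≤s (n≤1+n r))) q<n ml mr
    empty-side : room q ≡ 2 → hasLeft C q ≡ false ⊎ hasRight C q ≡ false → 3 + cnt ≤ n
    empty-side r2 (inj₁ hl) = missing₃ (mem C) n r (suc r) (suc q) r≥1 (n<1+n r) (<-trans (n<1+n (suc r)) (n<1+n q))
        q<n (noneLeft C q r hl (≤-trans (n<1+n r) (n≤1+n (suc r)))) ml mr
      where
      r≥1 : 1 ≤ r
      r≥1 = ≤-pred (≤-trans (≤-reflexive (sym r2)) (room≤left q))
    empty-side r2 (inj₂ hr) = missing₃ (mem C) n (suc r) (suc q) (suc (suc q)) (s≤s z≤n) (s≤s (s≤s (n≤1+n r)))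
        (n<1+n _) q+2≤n ml mr (noneRight C q (suc (suc q)) hr (<-trans (n<1+n q) (n<1+n (suc q))))
      where
      q+2≤n : suc (suc q) ≤ n
      q+2≤n = m≤o∸n⇒m+n≤o 2 (<⇒≤ q<n) (≤-trans (≤-reflexive (sym r2)) (room≤right q))
    by-cases : flanked C q ≡ true ⊎ flanked C q ≡ false → Dec (room q ≤ 1) → suc (weight C q + cnt) ≤ n
    by-cases (inj₁ fq) _ = subst (λ z → suc (z + cnt) ≤ n) (sym (weight-flanked C q fq)) both-neighbours
    by-cases (inj₂ fq) (yes r≤1) =
      ≤-trans (s≤s (+-monoˡ-≤ _ (≤-trans (≤-reflexive (weight-unflanked C q fq)) r≤1))) both-neighbours
    by-cases (inj₂ fq) (no r≰1) = subst (λ z → suc (z + cnt) ≤ n) (sym (trans (weight-unflanked C q fq) r2))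
      (empty-side r2 (∧-f {hasLeft C q} fq))
      where
      r2 : room q ≡ 2
      r2 = ≤-antisym (room≤2 q) (≰⇒> r≰1)

  -- An isolated point q forces weight C q + 1 labels outside C (at the ends: one neighbour).
  isolated-deficit : 2 ≤ n → ∀ C q → Isolated C q → suc (weight C q + ∣ C ∣) ≤ n
  isolated-deficit n2 C q (mq , ml , mr) rewrite card≡count C = by-position q (mem-range C q mq) ml mr
    where
    by-position : ∀ q → 1 ≤ q × q ≤ n → mem C (q ∸ 1) ≡ false → mem C (suc q) ≡ false →
      suc (weight C q + count (mem C) n) ≤ n
    by-position (suc zero) _ ml mr rewrite weight-unflanked C 1 (unflanked-1 C) = missing₁ (mem C) n 2 (s≤s z≤n) n2 mr
    by-position (suc (suc r)) (_ , qn) ml mr with suc (suc r) ≟ n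
    ... | yes refl rewrite weight-unflanked C (suc (suc r)) (unflanked-n C) =
          ≤-trans (s≤s (+-monoˡ-≤ _ (≤-trans (room≤right (suc (suc r))) (≤-reflexive (n∸n≡0 (suc (suc r)))))))
            (missing₁ (mem C) n (suc r) (s≤s z≤n) (n≤1+n _) ml)
    ... | no ne = interior-deficit C r (≤∧≢⇒< qn ne) ml mr

module PathFamily (n : ℕ) where
  open Weight n

  PathFam⇒NoIsolated : ∀ A → PathFam n A → NoIsolated A
  PathFam⇒NoIsolated A ((x , xA) , h) = (lab x , ∈⇒mem A x xA) , noiso
    where
    noiso : ∀ p → ¬ Isolated A p
    noiso p (mp , ml , mr) with mem⇒∈ℕ A p mp
    ... | y , refl , yA with h y yA
    ...   | inj₁ l = true≢false (trans (sym (∈ℕ⇒mem A (toℕ y) l)) ml)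
    ...   | inj₂ r = true≢false (trans (sym (∈ℕ⇒mem A (suc (lab y)) r)) mr)

  NoIsolated⇒PathFam : ∀ A → NoIsolated A → PathFam n A
  NoIsolated⇒PathFam A ((i , mi) , noiso) = (proj₁ (mem⇒∈ℕ A i mi) , proj₂ (proj₂ (mem⇒∈ℕ A i mi))) , h
    where
    h : ∀ x → x ∈ A → (toℕ x ∈ℕ A) ⊎ (suc (lab x) ∈ℕ A)
    h x xA with bool-cases (mem A (toℕ x)) | bool-cases (mem A (suc (lab x)))
    ... | inj₁ l | _ = inj₁ (mem⇒∈ℕ A (toℕ x) l)
    ... | inj₂ _ | inj₁ r = inj₂ (mem⇒∈ℕ A _ r)
    ... | inj₂ l | inj₂ r = ⊥-elim (noiso (lab x) (∈⇒mem A x xA , l , r))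

  included-∪ˡ : ∀ A B → Included A (A ∪ B)
  included-∪ˡ A B i e = trans (mem-∪ A B i) (t-∨ˡ (mem B i) e)

  included-∪ʳ : ∀ A B → Included B (A ∪ B)
  included-∪ʳ A B i e = trans (mem-∪ A B i) (t-∨ʳ (mem A i) e)

  included-absent : ∀ X C i → Included X C → mem C i ≡ false → mem X i ≡ false
  included-absent X C i s e with bool-cases (mem X i)
  ... | inj₂ f = f
  ... | inj₁ t = ⊥-elim (true≢false (trans (sym (s i t)) e))

  isolated-included : ∀ X C p → Included X C → mem X p ≡ true → Isolated C p → Isolated X p
  isolated-included X C p s m (_ , l , r) = m , included-absent X C (p ∸ 1) s l , included-absent X C (suc p) s r

  noIsolated-∪ : ∀ (B C : Subset n) → NoIsolated B → NoIsolated C → NoIsolated (B ∪ C)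
  noIsolated-∪ B C ((i , mi) , nb) (_ , nc) = (i , included-∪ˡ B C i mi) , noiso
    where
    noiso : ∀ p → ¬ Isolated (B ∪ C) p
    noiso p is@(mp , _) with mem-∪-true B C p mp
    ... | inj₁ e = nb p (isolated-included B (B ∪ C) p (included-∪ˡ B C) e is)
    ... | inj₂ e = nc p (isolated-included C (B ∪ C) p (included-∪ʳ B C) e is)

  noIsolated-⊤ : 2 ≤ n → NoIsolated ⊤
  noIsolated-⊤ n2 = (1 , mem-⊤ 1 (s≤s z≤n) (≤-trans (n≤1+n 1) n2)) , noiso
    where
    noiso : ∀ p → ¬ Isolated ⊤ p
    noiso zero (mp , ml , mr) = true≢false (trans (sym mp) (mem-zero (⊤ {n})))
    noiso (suc zero) (mp , ml , mr) = true≢false (trans (sym (mem-⊤ 2 (s≤s z≤n) n2)) mr)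
    noiso (suc (suc r)) (mp , ml , mr) = true≢false (trans (sym (mem-⊤ (suc r) (s≤s z≤n)
      (≤-trans (n≤1+n (suc r)) (proj₂ (mem-range (⊤ {n}) _ mp))))) ml)

  pathFam-unionClosed : 2 ≤ n → UnionClosed (PathFam n)
  pathFam-unionClosed n2 = NoIsolated⇒PathFam ⊤ (noIsolated-⊤ n2) , λ B C b c →
    NoIsolated⇒PathFam (B ∪ C) (noIsolated-∪ B C (PathFam⇒NoIsolated B b) (PathFam⇒NoIsolated C c))

  pathFam-nonempty : AllNonempty (PathFam n)
  pathFam-nonempty X p = proj₁ p

  edge : ℕ → Subset n
  edge a = tabulateSubset n (λ i → (i ≡ᵇ a) ∨ (i ≡ᵇ suc a))

  edge-members : ∀ a i → mem (edge a) i ≡ true → i ≡ a ⊎ i ≡ suc a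
  edge-members a i e with mem-range (edge a) i e
  ... | r₁ , r₂ with ∨-t {i ≡ᵇ a} (trans (sym (mem-tabulate n (λ i → (i ≡ᵇ a) ∨ (i ≡ᵇ suc a)) i r₁ r₂)) e)
  ...   | inj₁ x = inj₁ (≡ᵇ-≡ x)
  ...   | inj₂ x = inj₂ (≡ᵇ-≡ x)

  edge-absent : ∀ a j → j ≢ a → j ≢ suc a → mem (edge a) j ≡ false
  edge-absent a j n₁ n₂ with bool-cases (mem (edge a) j)
  ... | inj₂ f = f
  ... | inj₁ t with edge-members a j t
  ...   | inj₁ x = ⊥-elim (n₁ x)
  ...   | inj₂ x = ⊥-elim (n₂ x)

  edge-lo : ∀ a → 1 ≤ a → suc a ≤ n → mem (edge a) a ≡ true
  edge-lo a p q = trans (mem-tabulate n _ a p (≤-trans (n≤1+n a) q)) (t-∨ˡ (a ≡ᵇ suc a) (≡ᵇ-refl a))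

  edge-hi : ∀ a → 1 ≤ a → suc a ≤ n → mem (edge a) (suc a) ≡ true
  edge-hi a p q = trans (mem-tabulate n _ (suc a) (s≤s z≤n) q) (t-∨ʳ (suc a ≡ᵇ a) (≡ᵇ-refl a))

  edge-noIsolated : ∀ a → 1 ≤ a → suc a ≤ n → NoIsolated (edge a)
  edge-noIsolated a p q = (a , edge-lo a p q) , noiso
    where
    noiso : ∀ j → ¬ Isolated (edge a) j
    noiso j (mj , ml , mr) with edge-members a j mj
    ... | inj₁ refl = true≢false (trans (sym (edge-hi a p q)) mr)
    ... | inj₂ refl = true≢false (trans (sym (edge-lo a p q)) ml)

  edge-count : ∀ a → count (mem (edge a)) n ≤ 2
  edge-count a = ≤-trans (count-mono (mem (edge a)) (λ i → (i ≡ᵇ a) ∨ (i ≡ᵇ suc a)) n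
      (λ i p q e → trans (sym (mem-tabulate n _ i p q)) e))
    (≤-trans (count-∨ (λ i → i ≡ᵇ a) (λ i → i ≡ᵇ suc a) n) (+-mono-≤ (count-point a n) (count-point (suc a) n)))

below-pred : ∀ a p → 1 ≤ a → a ≤ p ∸ 2 → a < p ∸ 1
below-pred a (suc (suc p)) _ le = s≤s le
below-pred (suc a) (suc zero) _ ()
below-pred (suc a) zero _ ()

below : ∀ i p → i < p → i ≢ p ∸ 1 → i ≤ p ∸ 2
below i (suc p) (s≤s le) ne = suc[m]≤n⇒m≤pred[n] (≤∧≢⇒< le ne)

above : ∀ i p → p < i → i ≢ suc p → suc (suc p) ≤ i
above i p lt ne = ≤∧≢⇒< lt (λ e → ne (sym e))

three≤ : ∀ p → 1 ≤ p ∸ 2 → 3 ≤ p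
three≤ (suc (suc q)) le = s≤s (s≤s le)

pred≢self : ∀ c → 1 ≤ c → c ∸ 1 ≢ c
pred≢self (suc c) _ e = <-irrefl e (n<1+n c)

bound-mono : ∀ k a b c d → a ≤ b → c ≤ d → k + a + c ≤ k + b + d
bound-mono k a b c d ab cd = +-mono-≤ (+-monoʳ-≤ k ab) cd

-- one unit of level traded for one new element
bound-gain : ∀ k a b c d → a ≤ b → suc c ≤ d → suc k + a + c ≤ k + b + d
bound-gain k a b c d ab cd = ≤-trans (≤-reflexive (shift k a c)) (bound-mono k a b (suc c) d ab cd)
  where
  shift : ∀ k a c → suc k + a + c ≡ k + a + suc c
  shift = solve-∀

-- weight 2 → weight 1 paid for by one new element
bound-trade : ∀ k c d → suc c ≤ d → k + 2 + c ≤ k + 1 + d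
bound-trade k c d cd = ≤-trans (≤-reflexive (shift k c)) (+-monoʳ-≤ (k + 1) cd)
  where
  shift : ∀ k c → k + 2 + c ≡ k + 1 + suc c
  shift = solve-∀

-- weight 2 → weight 1 and one level, paid for by two new elements
bound-trade-suc : ∀ k c d → 2 + c ≤ d → suc k + 2 + c ≤ k + 1 + d
bound-trade-suc k c d cd = ≤-trans (≤-reflexive (shift k c)) (+-monoʳ-≤ (k + 1) cd)
  where
  shift : ∀ k c → suc k + 2 + c ≡ k + 1 + (2 + c)
  shift = solve-∀

module Extension (n : ℕ) where
  open Weight n
  open PathFamily n

  card-mono : ∀ X Y → Included X Y → ∣ X ∣ ≤ ∣ Y ∣
  card-mono X Y s rewrite card≡count X | card≡count Y = count-mono (mem X) (mem Y) n (λ i _ _ → s i)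

  card-gain₁ : ∀ X Y a → Included X Y → mem Y a ≡ true → mem X a ≡ false → suc ∣ X ∣ ≤ ∣ Y ∣
  card-gain₁ X Y a s ya xa rewrite card≡count X | card≡count Y with mem-range Y a ya
  ... | r₁ , r₂ = count-strict (mem X) (mem Y) n a (λ i _ _ → s i) r₁ r₂ xa ya

  card-gain₂ : ∀ X Y a b → Included X Y → mem Y a ≡ true → mem X a ≡ false → mem Y b ≡ true → mem X b ≡ false →
    a ≢ b → 2 + ∣ X ∣ ≤ ∣ Y ∣
  card-gain₂ X Y a b s ya xa yb xb ne rewrite card≡count X | card≡count Y with mem-range Y a ya | mem-range Y b yb
  ... | r₁ , r₂ | t₁ , t₂ = ≤-trans (s≤s (count-add-new (mem X) n a r₁ r₂ xa))
        (count-strict (λ i → mem X i ∨ (i ≡ᵇ a)) (mem Y) n b s' t₁ t₂ (add-absent (mem X) a b xb (λ e → ne (sym e))) yb)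
    where
    s' : ∀ i → 1 ≤ i → i ≤ n → (mem X i ∨ (i ≡ᵇ a)) ≡ true → mem Y i ≡ true
    s' i _ _ e with ∨-t {mem X i} e
    ... | inj₁ x = s i x
    ... | inj₂ x rewrite ≡ᵇ-≡ {i} {a} x = ya

  isolated? : ∀ A p → (Isolated A p) ⊎ (¬ Isolated A p)
  isolated? A p with bool-cases (mem A p) | bool-cases (mem A (p ∸ 1)) | bool-cases (mem A (suc p))
  ... | inj₁ m | inj₂ l | inj₂ r = inj₁ (m , l , r)
  ... | inj₂ m | _ | _ = inj₂ (λ x → true≢false (trans (sym (proj₁ x)) m))
  ... | inj₁ _ | inj₁ l | _ = inj₂ (λ x → true≢false (trans (sym l) (proj₁ (proj₂ x))))
  ... | inj₁ _ | inj₂ _ | inj₁ r = inj₂ (λ x → true≢false (trans (sym r) (proj₂ (proj₂ x))))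

  neighbour : ∀ X c → mem X c ≡ true → ¬ Isolated X c → ∃ λ c' → mem X c' ≡ true × (c' ≡ c ∸ 1 ⊎ c' ≡ suc c)
  neighbour X c xc ni with bool-cases (mem X (c ∸ 1)) | bool-cases (mem X (suc c))
  ... | inj₁ l | _ = c ∸ 1 , l , inj₁ refl
  ... | inj₂ _ | inj₁ r = suc c , r , inj₂ refl
  ... | inj₂ l | inj₂ r = ⊥-elim (ni (xc , l , r))

  -- if q is isolated in C and c ∈ C lies on a side of q where A has no point, then
  -- so does every neighbour c' ∈ C of c (it cannot jump over q)
  neighbour-same-side : ∀ A C q c c' → Isolated C q → mem C c ≡ true → (c' ≡ c ∸ 1 ⊎ c' ≡ suc c) →
    ((c < q × hasLeft A q ≡ false) ⊎ (q < c × hasRight A q ≡ false)) → mem A c' ≡ false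
  neighbour-same-side A C q c c' (_ , ql , qr) cc e (inj₁ (lt , hl)) = noneLeft A q c' hl (left c' e)
    where
    left : ∀ c' → (c' ≡ c ∸ 1 ⊎ c' ≡ suc c) → c' < q
    left .(c ∸ 1) (inj₁ refl) = ≤-<-trans (m∸n≤m c 1) lt
    left .(suc c) (inj₂ refl) with suc c ≟ q
    ... | no ne = ≤∧≢⇒< lt ne
    ... | yes refl = ⊥-elim (true≢false (trans (sym cc) ql))
  neighbour-same-side A C q (suc c₀) c' (_ , ql , qr) cc e (inj₂ (lt , hr)) = noneRight A q c' hr (right c' e)
    where
    right : ∀ c' → (c' ≡ suc c₀ ∸ 1 ⊎ c' ≡ suc (suc c₀)) → q < c'
    right .(suc (suc c₀)) (inj₂ refl) = <-trans lt (n<1+n _)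
    right .c₀ (inj₁ refl) with q ≟ c₀
    ... | no ne = ≤∧≢⇒< (≤-pred lt) ne
    ... | yes refl = ⊥-elim (true≢false (trans (sym cc) qr))
  neighbour-same-side A C q zero c' _ cc e (inj₂ _) = ⊥-elim (true≢false (trans (sym cc) (mem-zero C)))

  bound-from-part : ∀ k X Y q → Admissible k Y → mem Y q ≡ true → Isolated (X ∪ Y) q → BoundAt k (X ∪ Y) q
  bound-from-part k X Y q adm yq ic with isolated-included Y (X ∪ Y) q (included-∪ʳ X Y) yq ic
  ... | iy with weight (X ∪ Y) q <? weight Y q
  ...   | no nlt = ≤-trans (admissible-bounded k Y q adm iy) (bound-mono k _ _ _ _ (≮⇒≥ nlt) (card-mono Y (X ∪ Y) (included-∪ʳ X Y)))
  ...   | yes lt with weight-drop Y (X ∪ Y) q (included-∪ʳ X Y) lt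
  ...     | fC , fY with flanking-witness Y (X ∪ Y) q fY fC
  ...       | d , cd , yd , _ = ≤-trans (admissible-bounded k Y q adm iy) (≤-trans (+-monoˡ-≤ _ (+-monoʳ-≤ k (weight≤2 Y q)))
              (≤-trans (bound-trade k _ _ (card-gain₁ Y (X ∪ Y) d (included-∪ʳ X Y) cd yd))
                (≤-reflexive (cong (λ z → k + z + ∣ X ∪ Y ∣) (sym (weight-flanked (X ∪ Y) q fC))))))

  -- Isolated q ∈ A ∖ B of A ∪ B that B flanks from a side where A is empty: the flanking
  -- point c ∈ B is either isolated in B (bounded there) or comes with a neighbour in B ∖ A.
  bound-new-flank : ∀ k A B q c → Bounded (suc k) A → Admissible k B → Isolated A q → mem B q ≡ false →
    Isolated (A ∪ B) q → flanked (A ∪ B) q ≡ true → mem B c ≡ true → mem A c ≡ false →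
    ((c < q × hasLeft A q ≡ false) ⊎ (q < c × hasRight A q ≡ false)) → BoundAt k (A ∪ B) q
  bound-new-flank k A B q c hA adm ia bq ic fC bc ac side with isolated? B c
  ... | inj₁ ibc = ≤-trans (admissible-bounded k B c adm ibc) (≤-trans (+-monoˡ-≤ _ (+-monoʳ-≤ k (weight≤2 B c)))
        (≤-trans (bound-trade k _ _ (card-gain₁ B C q sB (proj₁ ic) bq)) weight-one))
    where
    C : Subset n
    C = A ∪ B
    sB : Included B C
    sB = included-∪ʳ A B
    weight-one : k + 1 + ∣ C ∣ ≤ k + weight C q + ∣ C ∣
    weight-one = ≤-reflexive (cong (λ z → k + z + ∣ C ∣) (sym (weight-flanked C q fC)))
  ... | inj₂ nibc with neighbour B c bc nibc
  ...   | c' , bc' , adj = ≤-trans (hA q ia) (≤-trans (+-monoˡ-≤ _ (+-monoʳ-≤ (suc k) (weight≤2 A q)))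
          (≤-trans (bound-trade-suc k _ _ (card-gain₂ A C c c' sA (sB c bc) ac (sB c' bc')
              (neighbour-same-side A C q c c' ic (sB c bc) adj side) (c≢c' adj)))
            (≤-reflexive (cong (λ z → k + z + ∣ C ∣) (sym (weight-flanked C q fC))))))
    where
    C : Subset n
    C = A ∪ B
    sA : Included A C
    sA = included-∪ˡ A B
    sB : Included B C
    sB = included-∪ʳ A B
    c≢c' : ∀ {c'} → (c' ≡ c ∸ 1 ⊎ c' ≡ suc c) → c ≢ c'
    c≢c' (inj₂ refl) e = <-irrefl e (n<1+n c)
    c≢c' (inj₁ refl) e = pred≢self c (proj₁ (mem-range B c bc)) (sym e)

  bound-from-A : ∀ k A B y → Bounded (suc k) A → Admissible k B → mem B y ≡ true → mem A y ≡ false →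
    ∀ q → mem A q ≡ true → mem B q ≡ false → Isolated (A ∪ B) q → BoundAt k (A ∪ B) q
  bound-from-A k A B y hA adm yB yA q aq bq ic with isolated-included A (A ∪ B) q (included-∪ˡ A B) aq ic
  ... | ia with weight (A ∪ B) q <? weight A q
  ...   | no nlt = ≤-trans (hA q ia) (bound-gain k _ _ _ _ (≮⇒≥ nlt)
            (card-gain₁ A (A ∪ B) y (included-∪ˡ A B) (included-∪ʳ A B y yB) yA))
  ...   | yes lt with weight-drop A (A ∪ B) q (included-∪ˡ A B) lt
  ...     | fC , fA with flanking-witness A (A ∪ B) q fA fC
  ...       | c , cc , ac , side with mem-∪-true A B c cc
  ...         | inj₁ x = ⊥-elim (true≢false (trans (sym x) ac))
  ...         | inj₂ bc = bound-new-flank k A B q c hA adm ia bq ic fC bc ac side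

  bounded-∪ : ∀ k A B y → Bounded (suc k) A → Admissible k B → mem B y ≡ true → mem A y ≡ false →
    Bounded k (A ∪ B)
  bounded-∪ k A B y hA adm yB yA q ic with bool-cases (mem B q)
  ... | inj₁ bq = bound-from-part k A B q adm bq ic
  ... | inj₂ bq with mem-∪-true A B q (proj₁ ic)
  ...   | inj₁ aq = bound-from-A k A B y hA adm yB yA q aq bq ic
  ...   | inj₂ x = ⊥-elim (true≢false (trans (sym x) bq))

  -- at level 0 the bound is impossible (isolated-deficit), so A ∪ B lies in 𝓕
  admissible-∪ : 2 ≤ n → ∀ k A B y → Bounded (suc k) A → Admissible k B →
    mem B y ≡ true → mem A y ≡ false → Admissible k (A ∪ B)
  admissible-∪ n2 zero A B y hA adm yB yA =
    inj₁ ((y , included-∪ʳ A B y yB) , λ q ic →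
      <-irrefl refl (≤-trans (isolated-deficit n2 (A ∪ B) q ic) (bounded-∪ zero A B y hA adm yB yA q ic)))
  admissible-∪ n2 (suc k) A B y hA adm yB yA =
    inj₂ (s≤s z≤n , (y , included-∪ʳ A B y yB) , bounded-∪ (suc k) A B y hA adm yB yA)

module Obstructions (n : ℕ) where
  open Weight n
  open PathFamily n
  open Extension n

  Obstruction : ℕ → Subset n → Set
  Obstruction k A = ∃ λ B → Admissible k B × (∃ λ y → mem B y ≡ true × mem A y ≡ false) × ¬ Admissible k (A ∪ B)

  isolated-∪ : ∀ A B p → Isolated A p → mem B (p ∸ 1) ≡ false → mem B (suc p) ≡ false → Isolated (A ∪ B) p
  isolated-∪ A B p (m , l , r) bl br = included-∪ˡ A B p m , trans (mem-∪ A B (p ∸ 1)) (f-∨ l bl) ,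
     trans (mem-∪ A B (suc p)) (f-∨ r br)

  card-∪-edge : ∀ A lo → ∣ A ∪ edge lo ∣ ≤ ∣ A ∣ + 2
  card-∪-edge A lo rewrite card≡count (A ∪ edge lo) | card≡count A =
    ≤-trans (≤-reflexive (count-cong _ _ n (λ i _ _ → mem-∪ A (edge lo) i)))
     (≤-trans (count-∨ (mem A) (mem (edge lo)) n) (+-monoʳ-≤ _ (edge-count lo)))

  card-∪-edge-adjacent : ∀ A lo x → (∀ i → mem (edge lo) i ≡ true → mem A i ≡ true ⊎ i ≡ x) →
    ∣ A ∪ edge lo ∣ ≤ suc ∣ A ∣
  card-∪-edge-adjacent A lo x h rewrite card≡count (A ∪ edge lo) | card≡count A =
    count-add-one (mem (A ∪ edge lo)) (mem A) n x h'
    where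
    h' : ∀ i → 1 ≤ i → i ≤ n → mem (A ∪ edge lo) i ≡ true → mem A i ≡ true ⊎ i ≡ x
    h' i _ _ e with mem-∪-true A (edge lo) i e
    ... | inj₁ a = inj₁ a
    ... | inj₂ b = h i b

  -- an edge whose only new point x avoids p ± 1 keeps p isolated at the cost of one element
  obstruct-adjacent : ∀ k A p lo x → Isolated A p → 1 ≤ lo → suc lo ≤ n →
    ((x ≡ lo × mem A (suc lo) ≡ true) ⊎ (x ≡ suc lo × mem A lo ≡ true)) →
    mem A x ≡ false → x ≢ p ∸ 1 → x ≢ suc p → Violates (suc k) A p → Obstruction k A
  obstruct-adjacent k A p lo x ia@(ap , al , ar) l₁ l₂ cs ax x₁ x₂ hyp =
    edge lo , inj₁ (edge-noIsolated lo l₁ l₂) , (x , new-point cs , ax) , not-admissible k C p ic violated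
    where
    C : Subset n
    C = A ∪ edge lo
    new-point : ((x ≡ lo × mem A (suc lo) ≡ true) ⊎ (x ≡ suc lo × mem A lo ≡ true)) → mem (edge lo) x ≡ true
    new-point (inj₁ (refl , _)) = edge-lo lo l₁ l₂
    new-point (inj₂ (refl , _)) = edge-hi lo l₁ l₂
    outside : ((x ≡ lo × mem A (suc lo) ≡ true) ⊎ (x ≡ suc lo × mem A lo ≡ true)) →
      ∀ j → mem A j ≡ false → j ≢ x → mem (edge lo) j ≡ false
    outside (inj₁ (refl , a₂)) j aj jx =
      edge-absent lo j jx (λ e → true≢false (trans (sym a₂) (trans (cong (mem A) (sym e)) aj)))
    outside (inj₂ (refl , a₁)) j aj jx =
      edge-absent lo j (λ e → true≢false (trans (sym a₁) (trans (cong (mem A) (sym e)) aj))) jx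
    ic : Isolated C p
    ic = isolated-∪ A (edge lo) p ia (outside cs (p ∸ 1) al (λ e → x₁ (sym e))) (outside cs (suc p) ar (λ e → x₂ (sym e)))
    old-or-x : ((x ≡ lo × mem A (suc lo) ≡ true) ⊎ (x ≡ suc lo × mem A lo ≡ true)) →
      ∀ i → (i ≡ lo ⊎ i ≡ suc lo) → mem A i ≡ true ⊎ i ≡ x
    old-or-x (inj₁ (refl , _)) i (inj₁ refl) = inj₂ refl
    old-or-x (inj₂ (_ , a₁)) i (inj₁ refl) = inj₁ a₁
    old-or-x (inj₁ (_ , a₂)) i (inj₂ refl) = inj₁ a₂
    old-or-x (inj₂ (refl , _)) i (inj₂ refl) = inj₂ refl
    card-C : ∣ C ∣ ≤ suc ∣ A ∣
    card-C = card-∪-edge-adjacent A lo x (λ i e → old-or-x cs i (edge-members lo i e))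
    violated : Violates k C p
    violated = ≤-trans (s≤s (≤-trans (+-mono-≤ (+-monoʳ-≤ k (weight-antitone A C p (included-∪ˡ A (edge lo)))) card-C)
                 (≤-reflexive (+-suc (k + weight A p) ∣ A ∣)))) hyp

  -- an edge away from p keeps p isolated at the cost of at most two elements
  obstruct-far : ∀ k A p lo → Isolated A p → 1 ≤ lo → suc lo ≤ n → mem A lo ≡ false →
    lo ≢ p ∸ 1 → lo ≢ suc p → suc lo ≢ p ∸ 1 → suc lo ≢ suc p →
    (k + weight (A ∪ edge lo) p + (∣ A ∣ + 2) < n) → Obstruction k A
  obstruct-far k A p lo ia l₁ l₂ alo a b c d fin =
    edge lo , inj₁ (edge-noIsolated lo l₁ l₂) , (lo , edge-lo lo l₁ l₂ , alo) ,
    not-admissible k (A ∪ edge lo) p ic (≤-<-trans (+-monoʳ-≤ _ (card-∪-edge A lo)) fin)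
    where
    ic : Isolated (A ∪ edge lo) p
    ic = isolated-∪ A (edge lo) p ia (edge-absent lo (p ∸ 1) (λ e → a (sym e)) (λ e → c (sym e)))
           (edge-absent lo (suc p) (λ e → b (sym e)) (λ e → d (sym e)))

  -- a far edge that makes p flanked trades weight 2 for weight 1 at the cost of two elements
  obstruct-flanking-edge : ∀ k A p lo → Isolated A p → 1 ≤ lo → suc lo ≤ n → mem A lo ≡ false →
    lo ≢ p ∸ 1 → lo ≢ suc p → suc lo ≢ p ∸ 1 → suc lo ≢ suc p →
    weight A p ≡ 2 → flanked (A ∪ edge lo) p ≡ true → Violates (suc k) A p → Obstruction k A
  obstruct-flanking-edge k A p lo ia l₁ l₂ alo a b c d w2 fC hyp = obstruct-far k A p lo ia l₁ l₂ alo a b c d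
    (subst (λ z → k + z + (∣ A ∣ + 2) < n) (sym (weight-flanked (A ∪ edge lo) p fC))
      (≤-trans (≤-reflexive (trade k ∣ A ∣)) (subst (λ z → suc (suc k + z + ∣ A ∣) ≤ n) w2 hyp)))
    where
    trade : ∀ k a → suc (k + 1 + (a + 2)) ≡ suc (suc k + 2 + a)
    trade = solve-∀

  covered-no-violation : ∀ k A p (s : ℕ → Bool) → (∀ i → 1 ≤ i → i ≤ n → mem A i ≡ true ⊎ s i ≡ true) →
    count s n ≤ suc (weight A p) → ¬ Violates (suc k) A p
  covered-no-violation k A p s cov cnt hyp =
    <-irrefl refl (≤-trans (s≤s (m≤n+m x k)) (≤-trans (≤-reflexive (shuffle k (weight A p) ∣ A ∣)) (≤-trans hyp covers)))
    where
    x : ℕ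
    x = ∣ A ∣ + suc (weight A p)
    shuffle : ∀ k w a → suc (k + (a + suc w)) ≡ suc (suc k + w + a)
    shuffle = solve-∀
    covers : n ≤ x
    covers = ≤-trans (subst (n ≤_) (cong (_+ count s n) (sym (card≡count A))) (count-cover (mem A) s n cov))
      (+-monoʳ-≤ ∣ A ∣ cnt)

  Attachable : Subset n → ℕ → ℕ → Set
  Attachable A p x = 1 ≤ x × x ≤ n × mem A x ≡ false × x ≢ p ∸ 1 × x ≢ suc p ×
    (mem A (x ∸ 1) ≡ true ⊎ mem A (suc x) ≡ true)

  attachable? : ∀ A p x → Attachable A p x ⊎ ¬ Attachable A p x
  attachable? A p x with 1 ≤? x | x ≤? n | bool-cases (mem A x) | x ≟ p ∸ 1 | x ≟ suc p
                       | bool-cases (mem A (x ∸ 1)) | bool-cases (mem A (suc x))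
  ... | no a | _ | _ | _ | _ | _ | _ = inj₂ λ g → a (proj₁ g)
  ... | yes _ | no a | _ | _ | _ | _ | _ = inj₂ λ g → a (proj₁ (proj₂ g))
  ... | yes _ | yes _ | inj₁ a | _ | _ | _ | _ = inj₂ λ g → true≢false (trans (sym a) (proj₁ (proj₂ (proj₂ g))))
  ... | yes _ | yes _ | inj₂ _ | yes a | _ | _ | _ = inj₂ λ g → proj₁ (proj₂ (proj₂ (proj₂ g))) a
  ... | yes _ | yes _ | inj₂ _ | no _ | yes a | _ | _ = inj₂ λ g → proj₁ (proj₂ (proj₂ (proj₂ (proj₂ g)))) a
  ... | yes a₁ | yes a₂ | inj₂ a₃ | no a₄ | no a₅ | inj₁ a₆ | _ = inj₁ (a₁ , a₂ , a₃ , a₄ , a₅ , inj₁ a₆)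
  ... | yes a₁ | yes a₂ | inj₂ a₃ | no a₄ | no a₅ | inj₂ _ | inj₁ a₇ = inj₁ (a₁ , a₂ , a₃ , a₄ , a₅ , inj₂ a₇)
  ... | yes _ | yes _ | inj₂ _ | no _ | no _ | inj₂ b₆ | inj₂ b₇ =
    inj₂ λ g → no-neighbour (proj₂ (proj₂ (proj₂ (proj₂ (proj₂ g)))))
    where
    no-neighbour : ¬ (mem A (x ∸ 1) ≡ true ⊎ mem A (suc x) ≡ true)
    no-neighbour (inj₁ e) = true≢false (trans (sym e) b₆)
    no-neighbour (inj₂ e) = true≢false (trans (sym e) b₇)

  obstruct-attachable : ∀ k A p x → Isolated A p → Violates (suc k) A p → Attachable A p x → Obstruction k A
  obstruct-attachable k A p (suc x₀) ia hyp (_ , xn , ax , x₁ , x₂ , inj₁ e) =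
    obstruct-adjacent k A p x₀ (suc x₀) ia (proj₁ (mem-range A x₀ e)) xn (inj₂ (refl , e)) ax x₁ x₂ hyp
  obstruct-attachable k A p x ia hyp (x≥1 , xn , ax , x₁ , x₂ , inj₂ e) =
    obstruct-adjacent k A p x x ia x≥1 (proj₂ (mem-range A (suc x) e)) (inj₁ (refl , e)) ax x₁ x₂ hyp

  Stuck : Subset n → ℕ → Set
  Stuck A p = ∀ x → x ≤ n → ¬ Attachable A p x

  left-stepwise : ∀ A p → Stuck A p → p ≤ n → ∀ t → 1 ≤ t → suc t ≤ p ∸ 2 → mem A t ≡ mem A (suc t)
  left-stepwise A p ng pn t t1 tp with bool-cases (mem A t) | bool-cases (mem A (suc t))
  ... | inj₁ e₁ | inj₁ e₂ = trans e₁ (sym e₂)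
  ... | inj₂ e₁ | inj₂ e₂ = trans e₁ (sym e₂)
  ... | inj₁ e₁ | inj₂ e₂ = ⊥-elim (ng (suc t) (≤-trans (<⇒≤ st<p) pn)
      (s≤s z≤n , ≤-trans (<⇒≤ st<p) pn , e₂ , (λ e → <-irrefl e (below-pred (suc t) p (s≤s z≤n) tp)) ,
       (λ e → <-irrefl e (<-trans st<p (n<1+n p))) , inj₁ e₁))
    where
    st<p : suc t < p
    st<p = <-≤-trans (below-pred (suc t) p (s≤s z≤n) tp) (m∸n≤m p 1)
  ... | inj₂ e₁ | inj₁ e₂ = ⊥-elim (ng t (≤-trans (<⇒≤ t<p) pn)
      (t1 , ≤-trans (<⇒≤ t<p) pn , e₁ ,
       (λ e → <-irrefl e (<-trans (n<1+n t) (below-pred (suc t) p (s≤s z≤n) tp))) ,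
       (λ e → <-irrefl e (<-trans t<p (n<1+n p))) , inj₂ e₂))
    where
    t<p : t < p
    t<p = <-trans (n<1+n t) (<-≤-trans (below-pred (suc t) p (s≤s z≤n) tp) (m∸n≤m p 1))

  right-stepwise : ∀ A p → Stuck A p → ∀ t → suc (suc p) ≤ t → suc t ≤ n → mem A t ≡ mem A (suc t)
  right-stepwise A p ng t pt tn with bool-cases (mem A t) | bool-cases (mem A (suc t))
  ... | inj₁ e₁ | inj₁ e₂ = trans e₁ (sym e₂)
  ... | inj₂ e₁ | inj₂ e₂ = trans e₁ (sym e₂)
  ... | inj₁ e₁ | inj₂ e₂ = ⊥-elim (ng (suc t) tn
      (s≤s z≤n , tn , e₂ , (λ e → <-irrefl (sym e) (≤-<-trans (m∸n≤m p 1) (<-trans p<t (n<1+n t)))) ,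
       (λ e → <-irrefl (sym (suc-injective e)) p<t) , inj₁ e₁))
    where
    p<t : p < t
    p<t = <-trans (n<1+n p) pt
  ... | inj₂ e₁ | inj₁ e₂ = ⊥-elim (ng t (≤-trans (n≤1+n t) tn)
      (≤-trans (s≤s z≤n) pt , ≤-trans (n≤1+n t) tn , e₁ ,
       (λ e → <-irrefl (sym e) (≤-<-trans (m∸n≤m p 1) (<-trans (n<1+n p) pt))) ,
       (λ e → <-irrefl (sym e) pt) , inj₂ e₂))

  left-full : ∀ A p → Stuck A p → p ≤ n → ∀ a → mem A a ≡ true → a < p → mem A (p ∸ 1) ≡ false →
    a ≤ p ∸ 2 × (∀ i → 1 ≤ i → i ≤ p ∸ 2 → mem A i ≡ true)
  left-full A (suc p₀) ng pn a ma ap ml = a≤ , full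
    where
    a≤ : a ≤ p₀ ∸ 1
    a≤ with a ≟ p₀
    ... | yes refl = ⊥-elim (true≢false (trans (sym ma) ml))
    ... | no ne = suc[m]≤n⇒m≤pred[n] (≤∧≢⇒< (≤-pred ap) ne)
    constant : ∀ i j → 1 ≤ i → i ≤ j → j ≤ suc p₀ ∸ 2 → mem A i ≡ mem A j
    constant = stepwise-constant (mem A) 1 (suc p₀ ∸ 2) (left-stepwise A (suc p₀) ng pn)
    full : ∀ i → 1 ≤ i → i ≤ p₀ ∸ 1 → mem A i ≡ true
    full i i1 ip with ≤-total i a
    ... | inj₁ ia = trans (constant i a i1 ia a≤) ma
    ... | inj₂ ai = trans (sym (constant a i (proj₁ (mem-range A a ma)) ai ip)) ma

  right-full : ∀ A p → Stuck A p → ∀ b → mem A b ≡ true → p < b → mem A (suc p) ≡ false →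
    suc (suc p) ≤ b × (∀ i → suc (suc p) ≤ i → i ≤ n → mem A i ≡ true)
  right-full A p ng b mb pb mr = b≥ , full
    where
    b≥ : suc (suc p) ≤ b
    b≥ with b ≟ suc p
    ... | yes refl = ⊥-elim (true≢false (trans (sym mb) mr))
    ... | no ne = ≤∧≢⇒< pb (λ e → ne (sym e))
    constant : ∀ i j → suc (suc p) ≤ i → i ≤ j → j ≤ n → mem A i ≡ mem A j
    constant = stepwise-constant (mem A) (suc (suc p)) n (right-stepwise A p ng)
    full : ∀ i → suc (suc p) ≤ i → i ≤ n → mem A i ≡ true
    full i i1 ip with ≤-total i b
    ... | inj₁ ib = trans (constant i b i1 ib (proj₂ (mem-range A b mb))) mb
    ... | inj₂ bi = trans (sym (constant b i b≥ bi ip)) mb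

  -- Stuck and flanked: A ⊇ [1, p-2] ∪ [p+2, n], so A misses only p ± 1.
  stuck-flanked : ∀ k A p → Isolated A p → Stuck A p → flanked A p ≡ true → ¬ Violates (suc k) A p
  stuck-flanked k A p (ap , al , ar) ng fA with anyBelow-witness A p n (proj₁ (∧-t fA))
                                             | anyAbove-witness A p n (proj₂ (∧-t fA))
  ... | a , a<p , ma | b , p<b , mb = covered-no-violation k A p neighbours covered
        (subst (λ w → count neighbours n ≤ suc w) (sym (weight-flanked A p fA)) (count-two-points (p ∸ 1) (suc p)))
    where
    neighbours : ℕ → Bool
    neighbours i = (i ≡ᵇ p ∸ 1) ∨ (i ≡ᵇ suc p)
    count-two-points : ∀ u v → count (λ i → (i ≡ᵇ u) ∨ (i ≡ᵇ v)) n ≤ 2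
    count-two-points u v = ≤-trans (count-∨ _ _ n) (+-mono-≤ (count-point u n) (count-point v n))
    left : ∀ i → 1 ≤ i → i ≤ p ∸ 2 → mem A i ≡ true
    left = proj₂ (left-full A p ng (proj₂ (mem-range A p ap)) a ma a<p al)
    right : ∀ i → suc (suc p) ≤ i → i ≤ n → mem A i ≡ true
    right = proj₂ (right-full A p ng b mb p<b ar)
    covered : ∀ i → 1 ≤ i → i ≤ n → mem A i ≡ true ⊎ neighbours i ≡ true
    covered i i1 iN with <-cmp i p
    ... | tri≈ _ refl _ = inj₁ ap
    ... | tri< lt _ _ with i ≟ p ∸ 1
    ...   | yes e = inj₂ (t-∨ˡ (i ≡ᵇ suc p) (fromT (≡⇒≡ᵇ i _ e)))
    ...   | no ne = inj₁ (left i i1 (below i p lt ne))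
    covered i i1 iN | tri> _ _ gt with i ≟ suc p
    ...   | yes e = inj₂ (t-∨ʳ (i ≡ᵇ p ∸ 1) (fromT (≡⇒≡ᵇ i _ e)))
    ...   | no ne = inj₁ (right i (above i p gt ne) iN)

  -- Nothing right of p and n - p ≥ 3: the edge {n-1, n} flanks p, whose weight is 2.
  left-block-far : ∀ k A p a → Isolated A p → Violates (suc k) A p → mem A a ≡ true → a < p →
    hasRight A p ≡ false → 3 ≤ p → 3 ≤ n ∸ p → Obstruction k A
  left-block-far k A p a ia@(ap , _ , _) hyp ma a<p hr p3 d3 =
    obstruct-flanking-edge k A p lo ia l₁ l₂ (noneRight A p lo hr p<lo)
      (λ e → <⇒≢ (≤-<-trans (m∸n≤m p 1) p<lo) (sym e)) (λ e → <⇒≢ sp<lo (sym e))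
      (λ e → <⇒≢ (<-trans (≤-<-trans (m∸n≤m p 1) p<lo) (n<1+n lo)) (sym e))
      (λ e → <⇒≢ (<-trans sp<lo (n<1+n lo)) (sym e)) w2 flanks hyp
    where
    n3 : 3 + p ≤ n
    n3 = m≤o∸n⇒m+n≤o 3 (proj₂ (mem-range A p ap)) d3
    lo : ℕ
    lo = n ∸ 1
    sp<lo : suc p < lo
    sp<lo = ∸-monoˡ-≤ 1 n3
    p<lo : p < lo
    p<lo = <-trans (n<1+n p) sp<lo
    l₁ : 1 ≤ lo
    l₁ = ≤-trans (s≤s z≤n) p<lo
    l₂ : suc lo ≤ n
    l₂ = ≤-reflexive (trans (+-comm 1 (n ∸ 1)) (m∸n+n≡m (≤-trans (s≤s z≤n) n3)))
    w2 : weight A p ≡ 2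
    w2 = trans (weight-unflanked A p (trans (cong (hasLeft A p ∧_) hr) (∧-zeroʳ _))) (room≡2 p p3 (≤-trans (n≤1+n _) n3))
    flanks : flanked (A ∪ edge lo) p ≡ true
    flanks rewrite hasLeft-intro (A ∪ edge lo) p a a<p (included-∪ˡ A (edge lo) a ma)
                 | hasRight-intro (A ∪ edge lo) p lo p<lo (included-∪ʳ A (edge lo) lo (edge-lo lo l₁ l₂)) = refl

  -- A ⊇ [1, p-2], nothing right of p and n - p ≤ 2: A misses only p - 1 and the
  -- n - p = weight labels beyond p, too few for a violation.
  left-block-tight : ∀ k A p → Isolated A p → (∀ i → 1 ≤ i → i ≤ p ∸ 2 → mem A i ≡ true) →
    hasRight A p ≡ false → 3 ≤ p → n ∸ p ≤ 2 → ¬ Violates (suc k) A p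
  left-block-tight k A p (ap , _ , _) left hr p3 d2 = covered-no-violation k A p beyond covered
    (subst (λ w → count beyond n ≤ suc w) (sym weight≡n-p)
      (≤-trans (count-∨ _ _ n) (+-mono-≤ (count-point (p ∸ 1) n) (count-above p n))))
    where
    weight≡n-p : weight A p ≡ n ∸ p
    weight≡n-p = trans (weight-unflanked A p (trans (cong (hasLeft A p ∧_) hr) (∧-zeroʳ _))) (room-right p p3 d2)
    beyond : ℕ → Bool
    beyond i = (i ≡ᵇ p ∸ 1) ∨ (p <ᵇ i)
    covered : ∀ i → 1 ≤ i → i ≤ n → mem A i ≡ true ⊎ beyond i ≡ true
    covered i i1 iN with <-cmp i p
    ... | tri≈ _ refl _ = inj₁ ap
    ... | tri> _ _ gt = inj₂ (t-∨ʳ (i ≡ᵇ p ∸ 1) (<ᵇ-t gt))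
    ... | tri< lt _ _ with i ≟ p ∸ 1
    ...   | yes e = inj₂ (t-∨ˡ (p <ᵇ i) (fromT (≡⇒≡ᵇ i _ e)))
    ...   | no ne = inj₁ (left i i1 (below i p lt ne))

  stuck-left-block : ∀ k A p a → Isolated A p → Stuck A p → Violates (suc k) A p →
    mem A a ≡ true → a < p → hasRight A p ≡ false → Obstruction k A
  stuck-left-block k A p a ia@(ap , al , _) ng hyp ma a<p hr = by-distance (3 ≤? n ∸ p)
    where
    lf : a ≤ p ∸ 2 × (∀ i → 1 ≤ i → i ≤ p ∸ 2 → mem A i ≡ true)
    lf = left-full A p ng (proj₂ (mem-range A p ap)) a ma a<p al
    p3 : 3 ≤ p
    p3 = three≤ p (≤-trans (proj₁ (mem-range A a ma)) (proj₁ lf))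
    by-distance : Dec (3 ≤ n ∸ p) → Obstruction k A
    by-distance (yes d3) = left-block-far k A p a ia hyp ma a<p hr p3 d3
    by-distance (no d3) = ⊥-elim (left-block-tight k A p ia (proj₂ lf) hr p3 (≤-pred (≰⇒> d3)) hyp)

  -- Nothing left of p and p - 1 ≥ 3: the edge {1, 2} flanks p, whose weight is 2.
  right-block-far : ∀ k A p b → Isolated A p → Violates (suc k) A p → mem A b ≡ true → p < b →
    hasLeft A p ≡ false → 2 + p ≤ n → 3 ≤ p ∸ 1 → Obstruction k A
  right-block-far k A p b ia hyp mb p<b hl p+2≤n d3 =
    obstruct-flanking-edge k A p 1 ia (s≤s z≤n) n≥2 (noneLeft A p 1 hl (≤-trans (s≤s (s≤s z≤n)) p4))
      (λ e → <⇒≢ (≤-trans (s≤s (s≤s z≤n)) d3) e) (λ e → <⇒≢ (s≤s (≤-trans (s≤s z≤n) p4)) e)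
      (λ e → <⇒≢ (≤-trans (s≤s (s≤s (s≤s z≤n))) d3) e) (λ e → <⇒≢ (s≤s (≤-trans (s≤s (s≤s z≤n)) p4)) e)
      w2 flanks hyp
    where
    p4 : 4 ≤ p
    p4 = m≤o∸n⇒m+n≤o 3 (≤-trans (s≤s z≤n) (≤-trans d3 (m∸n≤m p 1))) d3
    n≥2 : 2 ≤ n
    n≥2 = ≤-trans (s≤s (s≤s z≤n)) p+2≤n
    w2 : weight A p ≡ 2
    w2 = trans (weight-unflanked A p (cong (_∧ hasRight A p) hl)) (room≡2 p (≤-trans (n≤1+n 3) p4) p+2≤n)
    flanks : flanked (A ∪ edge 1) p ≡ true
    flanks rewrite hasLeft-intro (A ∪ edge 1) p 1 (≤-trans (s≤s (s≤s z≤n)) p4)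
                     (included-∪ʳ A (edge 1) 1 (edge-lo 1 (s≤s z≤n) n≥2))
                 | hasRight-intro (A ∪ edge 1) p b p<b (included-∪ˡ A (edge 1) b mb) = refl

  -- A ⊇ [p+2, n], nothing left of p and p - 1 ≤ 2: A misses only p + 1 and the
  -- p - 1 = weight labels before p.
  right-block-tight : ∀ k A p → Isolated A p → (∀ i → suc (suc p) ≤ i → i ≤ n → mem A i ≡ true) →
    hasLeft A p ≡ false → 2 + p ≤ n → p ∸ 1 ≤ 2 → ¬ Violates (suc k) A p
  right-block-tight k A p (ap , _ , _) right hl p+2≤n d2 = covered-no-violation k A p before covered
    (subst (λ w → count before n ≤ suc w) (sym weight≡p-1)
      (≤-trans (count-∨ _ _ n) (+-mono-≤ (count-point (suc p) n) (count-below p n))))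
    where
    weight≡p-1 : weight A p ≡ p ∸ 1
    weight≡p-1 = trans (weight-unflanked A p (cong (_∧ hasRight A p) hl)) (room-left p (m+n≤o⇒m≤o∸n 2 p+2≤n) d2)
    before : ℕ → Bool
    before i = (i ≡ᵇ suc p) ∨ (i <ᵇ p)
    covered : ∀ i → 1 ≤ i → i ≤ n → mem A i ≡ true ⊎ before i ≡ true
    covered i i1 iN with <-cmp i p
    ... | tri≈ _ refl _ = inj₁ ap
    ... | tri< lt _ _ = inj₂ (t-∨ʳ (i ≡ᵇ suc p) (<ᵇ-t lt))
    ... | tri> _ _ gt with i ≟ suc p
    ...   | yes e = inj₂ (t-∨ˡ (i <ᵇ p) (fromT (≡⇒≡ᵇ i _ e)))
    ...   | no ne = inj₁ (right i (above i p gt ne) iN)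

  stuck-right-block : ∀ k A p b → Isolated A p → Stuck A p → Violates (suc k) A p →
    mem A b ≡ true → p < b → hasLeft A p ≡ false → Obstruction k A
  stuck-right-block k A p b ia@(_ , _ , ar) ng hyp mb p<b hl = by-distance (3 ≤? p ∸ 1)
    where
    rf : suc (suc p) ≤ b × (∀ i → suc (suc p) ≤ i → i ≤ n → mem A i ≡ true)
    rf = right-full A p ng b mb p<b ar
    p+2≤n : 2 + p ≤ n
    p+2≤n = ≤-trans (proj₁ rf) (proj₂ (mem-range A b mb))
    by-distance : Dec (3 ≤ p ∸ 1) → Obstruction k A
    by-distance (yes d3) = right-block-far k A p b ia hyp mb p<b hl p+2≤n d3
    by-distance (no d3) = ⊥-elim (right-block-tight k A p ia (proj₂ rf) hl p+2≤n (≤-pred (≰⇒> d3)) hyp)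

  -- A = {p}: attach an edge far from p ({5, 6} if p ≤ 3, else {1, 2})
  obstruct-singleton : ∀ k → k + 6 ≤ n → ∀ A p → Isolated A p → (∀ i → mem A i ≡ true → i ≡ p) → Obstruction k A
  obstruct-singleton k kn A p ia single = far p ia single
    where
    card≤1 : ∣ A ∣ ≤ 1
    card≤1 rewrite card≡count A = count-single (mem A) n p (λ i _ _ e → single i e)
    n6 : 6 ≤ n
    n6 = m+n≤o⇒n≤o k kn
    small : ∀ lo q → k + weight (A ∪ edge lo) q + (∣ A ∣ + 2) < n
    small lo q = ≤-trans (s≤s (+-mono-≤ (+-monoʳ-≤ k (weight≤2 (A ∪ edge lo) q)) (+-monoˡ-≤ 2 card≤1)))
      (≤-trans (≤-reflexive (six k)) kn)
      where
      six : ∀ k → suc (k + 2 + (1 + 2)) ≡ k + 6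
      six = solve-∀
    absent : ∀ q → (∀ i → mem A i ≡ true → i ≡ q) → ∀ lo → lo ≢ q → mem A lo ≡ false
    absent q s' lo ne with bool-cases (mem A lo)
    ... | inj₂ f = f
    ... | inj₁ t = ⊥-elim (ne (s' lo t))
    far : ∀ q → Isolated A q → (∀ i → mem A i ≡ true → i ≡ q) → Obstruction k A
    far zero (m , _) _ = ⊥-elim (true≢false (trans (sym m) (mem-zero A)))
    far q@(suc zero) ia' s' =
      obstruct-far k A q 5 ia' (s≤s z≤n) n6 (absent q s' 5 λ ()) (λ ()) (λ ()) (λ ()) (λ ()) (small 5 q)
    far q@(suc (suc zero)) ia' s' =
      obstruct-far k A q 5 ia' (s≤s z≤n) n6 (absent q s' 5 λ ()) (λ ()) (λ ()) (λ ()) (λ ()) (small 5 q)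
    far q@(suc (suc (suc zero))) ia' s' =
      obstruct-far k A q 5 ia' (s≤s z≤n) n6 (absent q s' 5 λ ()) (λ ()) (λ ()) (λ ()) (λ ()) (small 5 q)
    far q@(suc (suc (suc (suc _)))) ia' s' =
      obstruct-far k A q 1 ia' (s≤s z≤n) (≤-trans (s≤s (s≤s z≤n)) n6)
        (absent q s' 1 λ ()) (λ ()) (λ ()) (λ ()) (λ ()) (small 1 q)

  -- Obstruction lemma: either an edge can be attached away from p, or A is stuck and the
  -- position of its other points decides which edge to add.
  obstruct : ∀ k → k + 6 ≤ n → ∀ A p → Isolated A p → Violates (suc k) A p → Obstruction k A
  obstruct k kn A p ia hyp with boundedSearch (Attachable A p) (attachable? A p) n
  ... | inj₁ (x , g) = obstruct-attachable k A p x ia hyp g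
  ... | inj₂ ng with bool-cases (hasLeft A p) | bool-cases (hasRight A p)
  ...   | inj₁ hl | inj₁ hr = ⊥-elim (stuck-flanked k A p ia ng (cong₂ _∧_ hl hr) hyp)
  ...   | inj₁ hl | inj₂ hr with anyBelow-witness A p n hl
  ...     | a , a<p , ma = stuck-left-block k A p a ia ng hyp ma a<p hr
  obstruct k kn A p ia hyp | inj₂ ng | inj₂ hl | inj₁ hr with anyAbove-witness A p n hr
  ...     | b , p<b , mb = stuck-right-block k A p b ia ng hyp mb p<b hl
  obstruct k kn A p ia hyp | inj₂ ng | inj₂ hl | inj₂ hr = obstruct-singleton k kn A p ia single
    where
    single : ∀ i → mem A i ≡ true → i ≡ p
    single i m with <-cmp i p
    ... | tri< lt _ _ = ⊥-elim (true≢false (trans (sym (hasLeft-intro A p i lt m)) hl))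
    ... | tri≈ _ e _ = e
    ... | tri> _ _ gt = ⊥-elim (true≢false (trans (sym (hasRight-intro A p i gt m)) hr))

module Characterisation (n : ℕ) (n6 : 6 ≤ n) where
  open Weight n
  open PathFamily n
  open Extension n
  open Obstructions n

  n2 : 2 ≤ n
  n2 = ≤-trans (s≤s (s≤s z≤n)) n6

  closureK : ℕ → Family n
  closureK k = closureIter k (PathFam n)

  inhabited⇒nonempty : ∀ A → Inhabited A → Nonempty A
  inhabited⇒nonempty A (i , m) with mem⇒∈ℕ A i m
  ... | x , _ , xA = x , xA

  nonempty⇒inhabited : ∀ A → Nonempty A → Inhabited A
  nonempty⇒inhabited A (x , xA) = lab x , ∈⇒mem A x xA

  violation-or-bounded : ∀ k A → (∃ λ p → Isolated A p × Violates k A p) ⊎ Bounded k A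
  violation-or-bounded k A with boundedSearch (λ p → Isolated A p × Violates k A p) violation? n
    where
    violation? : ∀ p → (Isolated A p × Violates k A p) ⊎ ¬ (Isolated A p × Violates k A p)
    violation? p with isolated? A p | suc (k + weight A p + ∣ A ∣) ≤? n
    ... | inj₁ i | yes l = inj₁ (i , l)
    ... | inj₂ ni | _ = inj₂ (λ v → ni (proj₁ v))
    ... | inj₁ _ | no nl = inj₂ (λ v → nl (proj₂ v))
  ... | inj₁ found = inj₁ found
  ... | inj₂ none = inj₂ bounded
    where
    bounded : Bounded k A
    bounded p ia with suc (k + weight A p + ∣ A ∣) ≤? n
    ... | yes l = ⊥-elim (none p (proj₂ (mem-range A p (proj₁ ia))) (ia , l))
    ... | no nl = ≤-pred (≰⇒> nl)

  closure-step : ∀ k → k + 6 ≤ n → (∀ B → (closureK k B → Admissible k B) × (Admissible k B → closureK k B)) →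
    ∀ A → (closure (closureK k) A → Admissible (suc k) A) × (Admissible (suc k) A → closure (closureK k) A)
  closure-step k k6 IH A = forward , backward
    where
    forward : closure (closureK k) A → Admissible (suc k) A
    forward c with violation-or-bounded (suc k) A
    ... | inj₂ bounded = inj₂ (s≤s z≤n , nonempty⇒inhabited A (proj₁ c) , bounded)
    ... | inj₁ (p , ia , hyp) with obstruct k k6 A p ia hyp
    ...   | B , admB , (y , yB , yA) , notAdm with closure-elim (closureK k) A c B (proj₂ (IH B) admB)
    ...     | inj₂ g = ⊥-elim (notAdm (proj₁ (IH (A ∪ B)) g))
    ...     | inj₁ absorbed = ⊥-elim (true≢false (trans (sym y∈A∪B) yA))
      where
      y∈A∪B : mem A y ≡ true
      y∈A∪B = trans (cong (λ Z → mem Z y) (sym absorbed)) (trans (mem-∪ A B y) (t-∨ʳ (mem A y) yB))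
    backward : Admissible (suc k) A → closure (closureK k) A
    backward (inj₁ noIso) = ⊆closureIter (PathFam n) (pathFam-unionClosed n2) pathFam-nonempty (suc k) A
                              (NoIsolated⇒PathFam A noIso)
    backward (inj₂ (_ , inh , hA)) =
      closure-intro (closureK k) (proj₁ (closureIter-unionClosed (PathFam n) (pathFam-unionClosed n2) pathFam-nonempty k))
        A (inhabited⇒nonempty A inh) join
      where
      join : ∀ Y → closureK k Y → A ∪ Y ≡ A ⊎ closureK k (A ∪ Y)
      join Y gY with absorbed-or-new A Y
      ... | inj₁ e = inj₁ e
      ... | inj₂ (y , yY , yA) = inj₂ (proj₂ (IH (A ∪ Y)) (admissible-∪ n2 k A Y y hA (proj₁ (IH Y) gY) yY yA))

  characterisation : ∀ k → k + 5 ≤ n → ∀ A → (closureK k A → Admissible k A) × (Admissible k A → closureK k A)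
  characterisation zero _ A = (λ pf → inj₁ (PathFam⇒NoIsolated A pf)) , back
    where
    back : Admissible 0 A → closureK 0 A
    back (inj₁ noIso) = NoIsolated⇒PathFam A noIso
    back (inj₂ (() , _))
  characterisation (suc k) kn = closure-step k (≤-trans (≤-reflexive (+-suc k 5)) kn)
    (characterisation k (≤-trans (n≤1+n _) kn))

module Extremes (n : ℕ) where
  open Weight n
  open PathFamily n
  open Extension n

  ≤max : ∀ (A : Subset n) m → IsMax A m → ∀ i → mem A i ≡ true → i ≤ lab m
  ≤max A m (_ , h) i e with mem⇒∈ℕ A i e
  ... | y , refl , yA = s≤s (h y yA)

  min≤ : ∀ (A : Subset n) m → IsMin A m → ∀ i → mem A i ≡ true → lab m ≤ i
  min≤ A m (_ , h) i e with mem⇒∈ℕ A i e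
  ... | y , refl , yA = s≤s (h y yA)

  maximum : ∀ A → Inhabited A → ∃ λ m → IsMax A m
  maximum A (i , mi) with largest (mem A) n i (proj₂ (mem-range A i mi)) mi
  ... | M , mM , h with fromLabel M (proj₁ (mem-range A M mM)) (proj₂ (mem-range A M mM))
  ...   | m , refl = m , mem⇒∈ A m mM ,
          λ y yA → ≤-pred (h (lab y) (proj₂ (mem-range A (lab y) (∈⇒mem A y yA))) (∈⇒mem A y yA))

  minimum : ∀ A → Inhabited A → ∃ λ m → IsMin A m
  minimum A (i , mi) with smallest (mem A) n i (proj₂ (mem-range A i mi)) mi
  ... | M , mM , h with fromLabel M (proj₁ (mem-range A M mM)) (proj₂ (mem-range A M mM))
  ...   | m , refl = m , mem⇒∈ A m mM , λ y yA → ≤-pred (h (lab y) (∈⇒mem A y yA))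

  inhabited? : ∀ A → Inhabited A ⊎ (∀ i → mem A i ≡ false)
  inhabited? A with nonempty? A
  ... | yes (x , xA) = inj₁ (lab x , ∈⇒mem A x xA)
  ... | no empty = inj₂ (λ i → subst (λ B → mem B i ≡ false) (sym (Empty-unique empty)) (mem-∅ {n} i))

  inhabited-card : ∀ A → 1 ≤ ∣ A ∣ → Inhabited A
  inhabited-card A le with inhabited? A
  ... | inj₁ inh = inh
  ... | inj₂ empty = ⊥-elim (<-irrefl refl (≤-trans le (≤-reflexive
        (trans (card≡count A) (count-none (mem A) n (λ i _ _ → empty i))))))

  some-isolated : ∀ A → Inhabited A → ¬ NoIsolated A → ∃ λ p → Isolated A p
  some-isolated A ne nf with boundedSearch (Isolated A) (isolated? A) n
  ... | inj₁ r = r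
  ... | inj₂ none = ⊥-elim (nf (ne , λ p ia → none p (proj₂ (mem-range A p (proj₁ ia))) ia))

  isolated-is-deleted : ∀ A m p → NoIsolated (A - m) → Isolated A p → p ≡ lab m
  isolated-is-deleted A m p (_ , noiso) ia with p ≟ lab m
  ... | yes e = e
  ... | no ne = ⊥-elim (noiso p (isolated-included (A - m) A p (λ i e → proj₁ (mem-minus-true A m i e))
                  (trans (mem-minus-other A m p ne) (proj₁ ia)) ia))

  alone-isolated : ∀ A (m : Fin n) → mem A (lab m) ≡ true → (∀ i → mem (A - m) i ≡ false) →
    Isolated A (lab m) × hasLeft A (lab m) ≡ false × hasRight A (lab m) ≡ false
  alone-isolated A m mM none =
    (mM , alone (lab m ∸ 1) (pred≢self (lab m) (s≤s z≤n)) , alone (suc (lab m)) (λ e → <-irrefl (sym e) (n<1+n _))) ,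
    nothing-left , nothing-right
    where
    alone : ∀ i → i ≢ lab m → mem A i ≡ false
    alone i ne = trans (sym (mem-minus-other A m i ne)) (none i)
    nothing-left : hasLeft A (lab m) ≡ false
    nothing-left with bool-cases (hasLeft A (lab m))
    ... | inj₂ f = f
    ... | inj₁ t with anyBelow-witness A (lab m) n t
    ...   | i , lt , mi = ⊥-elim (true≢false (trans (sym mi) (alone i (λ e → <-irrefl e lt))))
    nothing-right : hasRight A (lab m) ≡ false
    nothing-right with bool-cases (hasRight A (lab m))
    ... | inj₂ f = f
    ... | inj₁ t with anyAbove-witness A (lab m) n t
    ...   | i , lt , mi = ⊥-elim (true≢false (trans (sym mi) (alone i (λ e → <-irrefl (sym e) lt))))

  left-of : ∀ A p t → hasLeft A p ≡ false → mem A t ≡ true → p ≤ t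
  left-of A p t hl m with p ≤? t
  ... | yes pt = pt
  ... | no pt = ⊥-elim (true≢false (trans (sym (hasLeft-intro A p t (≰⇒> pt) m)) hl))

  right-of : ∀ A p t → hasRight A p ≡ false → mem A t ≡ true → t ≤ p
  right-of A p t hr m with t ≤? p
  ... | yes tp = tp
  ... | no tp = ⊥-elim (true≢false (trans (sym (hasRight-intro A p t (≰⇒> tp) m)) hr))

  weight≤1-start : ∀ A p → (1 ∈ℕ A ⊎ 2 ∈ℕ A) → hasLeft A p ≡ false → weight A p ≤ 1
  weight≤1-start A p t hl = ≤-trans (≤-reflexive (weight-unflanked A p (cong (_∧ hasRight A p) hl)))
    (≤-trans (room≤left p) (∸-monoˡ-≤ 1 (p≤2 t)))
    where
    p≤2 : (1 ∈ℕ A ⊎ 2 ∈ℕ A) → p ≤ 2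
    p≤2 (inj₁ x) = ≤-trans (left-of A p 1 hl (∈ℕ⇒mem A 1 x)) (s≤s z≤n)
    p≤2 (inj₂ x) = left-of A p 2 hl (∈ℕ⇒mem A 2 x)

  weight≤1-end : ∀ A p → ((n ∸ 1) ∈ℕ A ⊎ n ∈ℕ A) → hasRight A p ≡ false → weight A p ≤ 1
  weight≤1-end A p t hr = ≤-trans (≤-reflexive (weight-unflanked A p (trans (cong (hasLeft A p ∧_) hr) (∧-zeroʳ _))))
    (≤-trans (room≤right p) (n∸p≤1 (n-1≤p t)))
    where
    n-1≤p : ((n ∸ 1) ∈ℕ A ⊎ n ∈ℕ A) → n ∸ 1 ≤ p
    n-1≤p (inj₁ x) = right-of A p (n ∸ 1) hr (∈ℕ⇒mem A _ x)
    n-1≤p (inj₂ x) = ≤-trans (m∸n≤m n 1) (right-of A p n hr (∈ℕ⇒mem A _ x))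
    n∸p≤1 : n ∸ 1 ≤ p → n ∸ p ≤ 1
    n∸p≤1 le = ≤-trans (∸-monoʳ-≤ n le) (m∸[m∸1]≤1 n)
      where
      m∸[m∸1]≤1 : ∀ m → m ∸ (m ∸ 1) ≤ 1
      m∸[m∸1]≤1 zero = z≤n
      m∸[m∸1]≤1 (suc m) = ≤-reflexive (trans (+-∸-assoc 1 (≤-refl {m})) (cong suc (n∸n≡0 m)))

  isolated-short-of-max : ∀ A m → IsMax A m → ¬ NoIsolated A → ¬ NoIsolated (A - m) →
    ∃ λ p → Isolated A p × (hasRight A p ≡ true ⊎ hasLeft A p ≡ false)
  isolated-short-of-max A m imax nA nA' with inhabited? (A - m)
  ... | inj₂ none with alone-isolated A m (∈⇒mem A m (proj₁ imax)) none
  ...   | ia , hl , _ = lab m , ia , inj₂ hl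
  isolated-short-of-max A m imax nA nA' | inj₁ inh with some-isolated (A - m) inh nA'
  ...   | q , (mq , lq , rq) with mem-minus-true A m q mq
  ...     | aq , q≢M with bool-cases (mem A (suc q))
  ...       | inj₂ f = q , (aq , trans (sym (mem-minus-other A m (q ∸ 1) q-1≢M)) lq , f) ,
                inj₁ (hasRight-intro A q (lab m) q<M (∈⇒mem A m (proj₁ imax)))
    where
    q<M : q < lab m
    q<M = ≤∧≢⇒< (≤max A m imax q aq) q≢M
    q-1≢M : q ∸ 1 ≢ lab m
    q-1≢M e = <-irrefl e (≤-<-trans (m∸n≤m q 1) q<M)
  ...       | inj₁ t with some-isolated A (q , aq) nA
  ...         | p , ip = p , ip , inj₁ (hasRight-intro A p (lab m) p<M (∈⇒mem A m (proj₁ imax)))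
    where
    -- q + 1 ∈ A but q + 1 ∉ A ∖ {m}, so q + 1 = max A; as q ∈ A, max A is not isolated
    q+1≡M : suc q ≡ lab m
    q+1≡M with suc q ≟ lab m
    ... | yes e = e
    ... | no ne = ⊥-elim (true≢false (trans (sym t) (trans (sym (mem-minus-other A m (suc q) ne)) rq)))
    p<M : p < lab m
    p<M = ≤∧≢⇒< (≤max A m imax p (proj₁ ip)) λ e → true≢false (trans (sym aq)
            (trans (cong (λ z → mem A (z ∸ 1)) (trans q+1≡M (sym e))) (proj₁ (proj₂ ip))))

  isolated-short-of-min : ∀ A m → IsMin A m → ¬ NoIsolated A → ¬ NoIsolated (A - m) →
    ∃ λ p → Isolated A p × (hasLeft A p ≡ true ⊎ hasRight A p ≡ false)
  isolated-short-of-min A m imin nA nA' with inhabited? (A - m)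
  ... | inj₂ none with alone-isolated A m (∈⇒mem A m (proj₁ imin)) none
  ...   | ia , _ , hr = lab m , ia , inj₂ hr
  isolated-short-of-min A m imin nA nA' | inj₁ inh with some-isolated (A - m) inh nA'
  ...   | q , (mq , lq , rq) with mem-minus-true A m q mq
  ...     | aq , q≢M with bool-cases (mem A (q ∸ 1))
  ...       | inj₂ f = q , (aq , f , trans (sym (mem-minus-other A m (suc q) q+1≢M)) rq) ,
                inj₁ (hasLeft-intro A q (lab m) M<q (∈⇒mem A m (proj₁ imin)))
    where
    M<q : lab m < q
    M<q = ≤∧≢⇒< (min≤ A m imin q aq) (λ e → q≢M (sym e))
    q+1≢M : suc q ≢ lab m
    q+1≢M e = <-irrefl (sym e) (<-trans M<q (n<1+n q))
  ...       | inj₁ t with some-isolated A (q , aq) nA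
  ...         | p , ip = p , ip , inj₁ (hasLeft-intro A p (lab m) M<p (∈⇒mem A m (proj₁ imin)))
    where
    -- q - 1 ∈ A but q - 1 ∉ A ∖ {m}, so q - 1 = min A; as q ∈ A, min A is not isolated
    q-1≡M : q ∸ 1 ≡ lab m
    q-1≡M with q ∸ 1 ≟ lab m
    ... | yes e = e
    ... | no ne = ⊥-elim (true≢false (trans (sym t) (trans (sym (mem-minus-other A m (q ∸ 1) ne)) lq)))
    q≡M+1 : q ≡ suc (lab m)
    q≡M+1 = trans (sym (suc-pred-of q (proj₁ (mem-range A q aq)))) (cong suc q-1≡M)
      where
      suc-pred-of : ∀ q → 1 ≤ q → suc (q ∸ 1) ≡ q
      suc-pred-of (suc q) _ = refl
    M<p : lab m < p
    M<p = ≤∧≢⇒< (min≤ A m imin p (proj₁ ip)) λ e → true≢false (trans (sym aq)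
            (trans (cong (mem A) (trans q≡M+1 (cong suc e))) (proj₂ (proj₂ ip))))

  weight≤1-towards-start : ∀ A p → (1 ∈ℕ A ⊎ 2 ∈ℕ A) → (hasRight A p ≡ true ⊎ hasLeft A p ≡ false) → weight A p ≤ 1
  weight≤1-towards-start A p t (inj₂ hl) = weight≤1-start A p t hl
  weight≤1-towards-start A p t (inj₁ hr) with bool-cases (hasLeft A p)
  ... | inj₁ hl = ≤-reflexive (weight-flanked A p (cong₂ _∧_ hl hr))
  ... | inj₂ hl = weight≤1-start A p t hl

  weight≤1-towards-end : ∀ A p → ((n ∸ 1) ∈ℕ A ⊎ n ∈ℕ A) → (hasLeft A p ≡ true ⊎ hasRight A p ≡ false) → weight A p ≤ 1
  weight≤1-towards-end A p t (inj₂ hr) = weight≤1-end A p t hr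
  weight≤1-towards-end A p t (inj₁ hl) with bool-cases (hasRight A p)
  ... | inj₁ hr = ≤-reflexive (weight-flanked A p (cong₂ _∧_ hl hr))
  ... | inj₂ hr = weight≤1-end A p t hr

module ConditionAnalysis (n : ℕ) (n6 : 6 ≤ n) (k : ℕ) (k5 : k + 5 ≤ n) (A : Subset n)
  (notF : ¬ Weight.NoIsolated n A) (card : ∣ A ∣ ≤ n ∸ k ∸ 1) where
  open Weight n
  open PathFamily n
  open Extremes n
  open Conditions n k A

  Violated : Set
  Violated = ∃ λ p → Isolated A p × Violates k A p

  k+j≤n : ∀ j → j ≤ 5 → k + j ≤ n
  k+j≤n j le = ≤-trans (+-monoʳ-≤ k le) k5

  card-exact : ∀ j → j ≤ 5 → ∣ A ∣ ≡ n ∸ k ∸ j → k + j + ∣ A ∣ ≡ n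
  card-exact j j5 e = trans (cong (k + j +_) (trans e (∸-+-assoc n k j))) (m+[n∸m]≡n (k+j≤n j j5))

  card-at-most : ∀ j → j ≤ 5 → ∣ A ∣ ≤ n ∸ k ∸ j → k + j + ∣ A ∣ ≤ n
  card-at-most j j5 e = ≤-trans (+-monoʳ-≤ (k + j) (≤-trans e (≤-reflexive (∸-+-assoc n k j))))
    (≤-reflexive (m+[n∸m]≡n (k+j≤n j j5)))

  card-positive : ∀ j → j ≤ 4 → ∣ A ∣ ≡ n ∸ k ∸ j → 1 ≤ ∣ A ∣
  card-positive j j4 sz = subst (1 ≤_) (sym (trans sz (∸-+-assoc n k j)))
    (m+n≤o⇒m≤o∸n 1 (≤-trans (≤-reflexive (sym (+-suc k j))) (k+j≤n (suc j) (s≤s j4))))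

  violation : ∀ j p → suc (weight A p) ≤ j → k + j + ∣ A ∣ ≤ n → Violates k A p
  violation j p le h = ≤-trans (≤-reflexive (shift k (weight A p) ∣ A ∣)) (≤-trans (+-monoˡ-≤ ∣ A ∣ (+-monoʳ-≤ k le)) h)
    where
    shift : ∀ k w a → suc (k + w + a) ≡ k + suc w + a
    shift = solve-∀

  satisfied : ∀ j p → j ≤ weight A p → k + j + ∣ A ∣ ≡ n → BoundAt k A p
  satisfied j p le e = ≤-trans (≤-reflexive (sym e)) (+-monoˡ-≤ ∣ A ∣ (+-monoʳ-≤ k le))

  within-mem : ∀ a b → Within a b → ∀ i → mem A i ≡ true → a ≤ i × i ≤ b
  within-mem a b wi i m with mem⇒∈ℕ A i m
  ... | x , refl , xA = wi x xA

  inhabited-from : (1 ∈ℕ A ⊎ 2 ∈ℕ A) → Inhabited A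
  inhabited-from (inj₁ x) = 1 , ∈ℕ⇒mem A 1 x
  inhabited-from (inj₂ x) = 2 , ∈ℕ⇒mem A 2 x

  -- (i) 1 is isolated with weight 0
  violated-c1 : c1 → Violated
  violated-c1 (one , no2) = 1 , (∈ℕ⇒mem A 1 one , mem-zero A , mem-absent A 2 no2) ,
    violation 1 1 (s≤s (≤-reflexive (weight-unflanked A 1 (unflanked-1 A)))) (card-at-most 1 (s≤s z≤n) card)

  -- (ii) n is isolated with weight 0
  violated-c2 : c2 → Violated
  violated-c2 (nn , no') = n , (∈ℕ⇒mem A n nn , mem-absent A (n ∸ 1) no' , mem-beyond A (suc n) ≤-refl) ,
    violation 1 n (s≤s (≤-trans (≤-reflexive (weight-unflanked A n (unflanked-n A)))
      (≤-trans (room≤right n) (≤-reflexive (n∸n≡0 n))))) (card-at-most 1 (s≤s z≤n) card)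

  -- (vii) some isolated point lies left of max A or has nothing to its left: weight ≤ 1
  violated-c7 : c7 → Violated
  violated-c7 (wi , tL , sz , (m , imax , nDel)) with isolated-short-of-max A m imax notF
                                                        (λ f → nDel (NoIsolated⇒PathFam (A - m) f))
  ... | p , ia , side = p , ia , violation 2 p (s≤s (weight≤1-towards-start A p tL side)) (≤-reflexive (card-exact 2 (s≤s (s≤s z≤n)) sz))

  violated-c8 : c8 → Violated
  violated-c8 (wi , tR , sz , (m , imin , nDel)) with isolated-short-of-min A m imin notF
                                                        (λ f → nDel (NoIsolated⇒PathFam (A - m) f))
  ... | p , ia , side = p , ia , violation 2 p (s≤s (weight≤1-towards-end A p tR side)) (≤-reflexive (card-exact 2 (s≤s (s≤s z≤n)) sz))

  -- (ix) A meets both ends, so every isolated point has weight ≤ 1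
  violated-c9 : c9 → Violated
  violated-c9 (sz , tL , tR) with some-isolated A (inhabited-from tL) notF
  ... | p , ia = p , ia , violation 2 p (s≤s weight≤1) (≤-reflexive (card-exact 2 (s≤s (s≤s z≤n)) sz))
    where
    weight≤1 : weight A p ≤ 1
    weight≤1 with bool-cases (hasRight A p)
    ... | inj₁ hr = weight≤1-towards-start A p tL (inj₁ hr)
    ... | inj₂ hr = weight≤1-end A p tR hr

  -- (xii) j is isolated and flanked, so it has weight 1
  violated-c12 : c12 → Violated
  violated-c12 (wi , sz , (j , jA , (mn , mx , imn , imx , lt₁ , lt₂) , nl , nr)) =
    lab j , ia , violation 2 (lab j) (s≤s (≤-reflexive (weight-flanked A (lab j) fj)))
      (≤-reflexive (card-exact 2 (s≤s (s≤s z≤n)) sz))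
    where
    ia : Isolated A (lab j)
    ia = ∈⇒mem A j jA , ∉ℕ⇒absent A (toℕ j) nl , ∉ℕ⇒absent A (suc (lab j)) nr
    fj : flanked A (lab j) ≡ true
    fj rewrite hasLeft-intro A (lab j) (lab mn) (s≤s lt₁) (∈⇒mem A mn (proj₁ imn))
             | hasRight-intro A (lab j) (lab mx) (s≤s lt₂) (∈⇒mem A mx (proj₁ imx)) = refl

  -- (xiv) any isolated point: weight ≤ 2
  violated-c14 : Inhabited A → c14 → Violated
  violated-c14 inh le with some-isolated A inh notF
  ... | p , ia = p , ia , violation 3 p (s≤s (weight≤2 A p)) (card-at-most 3 (s≤s (s≤s (s≤s z≤n))) le)

  violated-of-negCond : Inhabited A → NegCond → Violated
  violated-of-negCond inh (inj₁ c) = violated-c1 c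
  violated-of-negCond inh (inj₂ (inj₁ c)) = violated-c2 c
  violated-of-negCond inh (inj₂ (inj₂ (inj₁ c))) = violated-c7 c
  violated-of-negCond inh (inj₂ (inj₂ (inj₂ (inj₁ c)))) = violated-c8 c
  violated-of-negCond inh (inj₂ (inj₂ (inj₂ (inj₂ (inj₁ c))))) = violated-c9 c
  violated-of-negCond inh (inj₂ (inj₂ (inj₂ (inj₂ (inj₂ (inj₁ c)))))) = violated-c12 c
  violated-of-negCond inh (inj₂ (inj₂ (inj₂ (inj₂ (inj₂ (inj₂ c)))))) = violated-c14 inh c

  two≤isolated : ∀ p → Isolated A p → mem A 2 ≡ true → 2 ≤ p
  two≤isolated (suc (suc p)) ia t = s≤s (s≤s z≤n)
  two≤isolated (suc zero) ia t = ⊥-elim (true≢false (trans (sym t) (proj₂ (proj₂ ia))))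
  two≤isolated zero ia t = ⊥-elim (true≢false (trans (sym (proj₁ ia)) (mem-zero A)))

  isolated<n : ∀ p → Isolated A p → mem A (n ∸ 1) ≡ true → p < n
  isolated<n p ia t = ≤∧≢⇒< (proj₂ (mem-range A p (proj₁ ia))) λ { refl → true≢false (trans (sym t) (proj₁ (proj₂ ia))) }

  <n-of-≤pred : ∀ p → p ≤ n ∸ 1 → p < n
  <n-of-≤pred p le = ≤-trans (s≤s le) (≤-reflexive (trans (+-comm 1 (n ∸ 1)) (m∸n+n≡m (≤-trans (s≤s z≤n) n6))))

  -- (iii)–(vi): |A| = n - k - 1 and no isolated point sits at 1 or n, so all weights are ≥ 1
  bounded-interior : ∣ A ∣ ≡ n ∸ k ∸ 1 → (∀ p → Isolated A p → 2 ≤ p × p < n) → Bounded k A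
  bounded-interior sz h p ia = satisfied 1 p (weight≥1 A p (proj₁ (h p ia)) (proj₂ (h p ia))) (card-exact 1 (s≤s z≤n) sz)

  weight≡2 : ∀ p → flanked A p ≡ false → 3 ≤ p → p ≤ n ∸ 2 → weight A p ≡ 2
  weight≡2 p fp p3 pn = trans (weight-unflanked A p fp)
    (room≡2 p p3 (≤-trans (≤-reflexive (+-comm 2 p)) (m≤o∸n⇒m+n≤o p (≤-trans (s≤s (s≤s z≤n)) n6) pn)))

  -- (x) the only isolated point is max A, which lies in [3, n-2] with nothing to its right
  bounded-c10 : c10 → Bounded k A
  bounded-c10 (wi , sz , (m , imax , del)) p ia = satisfied 2 p (≤-reflexive (sym w2)) (card-exact 2 (s≤s (s≤s z≤n)) sz)
    where
    M : ℕ
    M = lab m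
    noIso : NoIsolated (A - m)
    noIso = PathFam⇒NoIsolated (A - m) del
    p≡M : p ≡ M
    p≡M = isolated-is-deleted A m p noIso ia
    iaM : Isolated A M
    iaM = subst (Isolated A) p≡M ia
    nothing-right : hasRight A M ≡ false
    nothing-right with bool-cases (hasRight A M)
    ... | inj₂ f = f
    ... | inj₁ t with anyAbove-witness A M n t
    ...   | i , lt , mi = ⊥-elim (<-irrefl refl (<-≤-trans lt (≤max A m imax i mi)))
    -- another point i of A lies left of M - 1, so M ≥ 3
    M≥3 : 3 ≤ M
    M≥3 with proj₁ noIso
    ... | i , mi with mem-minus-true A m i mi
    ...   | ai , i≢M = three≤ M (≤-trans (proj₁ (mem-range A i ai))
            (below i M (≤∧≢⇒< (≤max A m imax i ai) i≢M)
              λ e → true≢false (trans (sym ai) (trans (cong (mem A) e) (proj₁ (proj₂ iaM))))))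
    w2 : weight A p ≡ 2
    w2 = trans (cong (weight A) p≡M) (weight≡2 M (trans (cong (hasLeft A M ∧_) nothing-right) (∧-zeroʳ _)) M≥3
           (proj₂ (within-mem 1 (n ∸ 2) wi M (proj₁ iaM))))

  bounded-c11 : c11 → Bounded k A
  bounded-c11 (wi , sz , (m , imin , del)) p ia = satisfied 2 p (≤-reflexive (sym w2)) (card-exact 2 (s≤s (s≤s z≤n)) sz)
    where
    M : ℕ
    M = lab m
    noIso : NoIsolated (A - m)
    noIso = PathFam⇒NoIsolated (A - m) del
    p≡M : p ≡ M
    p≡M = isolated-is-deleted A m p noIso ia
    iaM : Isolated A M
    iaM = subst (Isolated A) p≡M ia
    nothing-left : hasLeft A M ≡ false
    nothing-left with bool-cases (hasLeft A M)
    ... | inj₂ f = f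
    ... | inj₁ t with anyBelow-witness A M n t
    ...   | i , lt , mi = ⊥-elim (<-irrefl refl (≤-<-trans (min≤ A m imin i mi) lt))
    -- another point i of A lies right of M + 1, so M ≤ n - 2
    M≤n-2 : M ≤ n ∸ 2
    M≤n-2 with proj₁ noIso
    ... | i , mi with mem-minus-true A m i mi
    ...   | ai , i≢M = m+n≤o⇒m≤o∸n M (≤-trans (≤-reflexive (+-comm M 2)) (≤-trans
            (above i M (≤∧≢⇒< (min≤ A m imin i ai) (λ e → i≢M (sym e)))
              λ e → true≢false (trans (sym ai) (trans (cong (mem A) e) (proj₂ (proj₂ iaM)))))
            (proj₂ (mem-range A i ai))))
    w2 : weight A p ≡ 2
    w2 = trans (cong (weight A) p≡M) (weight≡2 M (cong (_∧ hasRight A M) nothing-left)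
           (proj₁ (within-mem 3 n wi M (proj₁ iaM))) M≤n-2)

  -- (xiii) isolated points in [3, n-2] are never strictly between min A and max A
  bounded-c13 : c13 → Bounded k A
  bounded-c13 (wi , sz , h) p ia = satisfied 2 p (≤-reflexive (sym w2)) (card-exact 2 (s≤s (s≤s z≤n)) sz)
    where
    ap : mem A p ≡ true
    ap = proj₁ ia
    unflanked : flanked A p ≡ false
    unflanked with bool-cases (flanked A p)
    ... | inj₂ f = f
    ... | inj₁ t with anyBelow-witness A p n (proj₁ (∧-t t)) | anyAbove-witness A p n (proj₂ (∧-t t))
                    | minimum A (p , ap) | maximum A (p , ap) | fromLabel p (proj₁ (mem-range A p ap)) (proj₂ (mem-range A p ap))
    ...   | a , a<p , ma | b , p<b , mb | mn , imn | mx , imx | j , refl =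
            ⊥-elim (isolated (h j (mem⇒∈ A j ap) mn mx imn imx
               (≤-pred (≤-<-trans (min≤ A mn imn a ma) a<p))
               (≤-pred (≤-trans p<b (≤max A mx imx b mb)))))
      where
      isolated : ¬ ((toℕ j ∈ℕ A) ⊎ (suc (lab j) ∈ℕ A))
      isolated (inj₁ x) = true≢false (trans (sym (∈ℕ⇒mem A _ x)) (proj₁ (proj₂ ia)))
      isolated (inj₂ x) = true≢false (trans (sym (∈ℕ⇒mem A _ x)) (proj₂ (proj₂ ia)))
    w2 : weight A p ≡ 2
    w2 = weight≡2 p unflanked (proj₁ (within-mem 3 (n ∸ 2) wi p ap)) (proj₂ (within-mem 3 (n ∸ 2) wi p ap))

  admissible-of-posCond : 1 ≤ k → PosCond → Admissible k A
  admissible-of-posCond k1 c = inj₂ (k1 , bounded c)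
    where
    bounded : PosCond → Inhabited A × Bounded k A
    bounded (inj₁ (one , two , wi , sz)) = (1 , ∈ℕ⇒mem A 1 one) , bounded-interior sz λ p ia →
      two≤isolated p ia (∈ℕ⇒mem A 2 two) , <n-of-≤pred p (proj₂ (within-mem 1 (n ∸ 1) wi p (proj₁ ia)))
    bounded (inj₂ (inj₁ (nm1 , nn , wi , sz))) = (n , ∈ℕ⇒mem A n nn) , bounded-interior sz λ p ia →
      proj₁ (within-mem 2 n wi p (proj₁ ia)) , isolated<n p ia (∈ℕ⇒mem A (n ∸ 1) nm1)
    bounded (inj₂ (inj₂ (inj₁ (wi , sz)))) = inhabited-card A (card-positive 1 (s≤s z≤n) sz) , bounded-interior sz λ p ia →
      proj₁ (within-mem 2 (n ∸ 1) wi p (proj₁ ia)) , <n-of-≤pred p (proj₂ (within-mem 2 (n ∸ 1) wi p (proj₁ ia)))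
    bounded (inj₂ (inj₂ (inj₂ (inj₁ (one , two , nm1 , nn , sz))))) = (1 , ∈ℕ⇒mem A 1 one) , bounded-interior sz λ p ia →
      two≤isolated p ia (∈ℕ⇒mem A 2 two) , isolated<n p ia (∈ℕ⇒mem A (n ∸ 1) nm1)
    bounded (inj₂ (inj₂ (inj₂ (inj₂ (inj₁ c@(_ , _ , (m , imax , _))))))) =
      (lab m , ∈⇒mem A m (proj₁ imax)) , bounded-c10 c
    bounded (inj₂ (inj₂ (inj₂ (inj₂ (inj₂ (inj₁ c@(_ , _ , (m , imin , _)))))))) =
      (lab m , ∈⇒mem A m (proj₁ imin)) , bounded-c11 c
    bounded (inj₂ (inj₂ (inj₂ (inj₂ (inj₂ (inj₂ c@(_ , sz , _))))))) =
      inhabited-card A (card-positive 2 (s≤s (s≤s z≤n)) sz) , bounded-c13 c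

theorem3 : ∀ (n : ℕ) → 6 ≤ n → ∀ (k : ℕ) → 1 ≤ k → k ≤ n ∸ 5 →
    ∀ (A : Subset n) → ¬ PathFam n A → ∣ A ∣ ≤ n ∸ k ∸ 1 →
    (Conditions.NegCond n k A → ¬ closureIter k (PathFam n) A)
    × (Conditions.PosCond n k A → closureIter k (PathFam n) A)
theorem3 n n6 k k1 kn A notF card = negative , positive
  where
  k5 : k + 5 ≤ n
  k5 = m≤o∸n⇒m+n≤o k (≤-trans (n≤1+n 5) n6) kn
  notF' : ¬ Weight.NoIsolated n A
  notF' f = notF (PathFamily.NoIsolated⇒PathFam n A f)
  open Weight n using (not-admissible)
  open Characterisation n n6 using (characterisation)
  open ConditionAnalysis n n6 k k5 A notF' card using (violated-of-negCond; admissible-of-posCond)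

  negative : Conditions.NegCond n k A → ¬ closureIter k (PathFam n) A
  negative c cl with proj₁ (characterisation k k5 A) cl
  ... | inj₁ noIso = notF' noIso
  ... | adm@(inj₂ (_ , inh , _)) with violated-of-negCond inh c
  ...   | p , ia , violated = not-admissible k A p ia violated adm

  positive : Conditions.PosCond n k A → closureIter k (PathFam n) A
  positive c = proj₂ (characterisation k k5 A) (admissible-of-posCond k1 c)
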